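{- Let $d\in\mathbb N$ and let $w\in\mathbb Z^{V_d}$ be a valid outcome with $\#\mathrm{supp}^+(w)=4$. Then $\deg(w)\leq 5$.
   Context: $V_d=\{(i,j)\in\mathbb Z_{\geq0}^2\mid i+j\leq d\}$, $\deg(i,j)=i+j$. A chip configuration is $w\in\mathbb Z^{V_d}$. A splitting move at $p\in V_{d-1}$ decreases $w_p$ by $1$ and increases $w_{p+(1,0)}$, $w_{p+(0,1)}$ by $1$; an unsplitting move is its inverse. An outcome is a configuration reachable from the zero configuration by finitely many moves. $\mathrm{supp}^+(w)=\{(i,j)\mid w_{i,j}>0\}$, $\mathrm{supp}(w)=\{(i,j)\mid w_{i,j}\neq 0\}$, $\deg(w)=\max\{i+j\mid (i,j)\in\mathrm{supp}(w)\}$; $w$ is valid if $w_{i,j}\geq 0$ for all $(i,j)\neq(0,0)$. -}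

module Defs where

open import Data.Nat as ℕ using (ℕ; zero; suc; _<_; _≤_) renaming (_+_ to _+ℕ_)
open import Data.Integer as ℤ using (ℤ; +_; _+_; _-_)
open import Data.Bool using (Bool; true; false; _∧_)
open import Data.List using (List; []; _∷_; length; filter; map; concatMap; upTo)
open import Data.List.Relation.Unary.All using (All)
open import Data.Product using (_×_; _,_; ∃)
open import Relation.Nullary.Decidable using (⌊_⌋)
open import Relation.Binary.PropositionalEquality using (_≡_; _≢_)

-- A chip configuration: a function on ℤ_{≥0}^2 (values outside V_d are
-- forced to be 0 for outcomes, since moves only touch V_d).
Config : Set
Config = ℕ → ℕ → ℤ

zeroConfig : Config
zeroConfig _ _ = + 0

ind : Bool → ℤ
ind true  = + 1
ind false = + 0

at : ℕ → ℕ → ℕ → ℕ → Bool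
at i j x y = ⌊ x ℕ.≟ i ⌋ ∧ ⌊ y ℕ.≟ j ⌋

splitAt : ℕ → ℕ → Config → Config
splitAt i j w x y =
  w x y - ind (at i j x y) + ind (at (suc i) j x y) + ind (at i (suc j) x y)

unsplitAt : ℕ → ℕ → Config → Config
unsplitAt i j w x y =
  w x y + ind (at i j x y) - ind (at (suc i) j x y) - ind (at i (suc j) x y)

data Move : Set where
  split   : ℕ → ℕ → Move
  unsplit : ℕ → ℕ → Move

MoveIn : ℕ → Move → Set
MoveIn d (split i j)   = i +ℕ j < d
MoveIn d (unsplit i j) = i +ℕ j < d

applyMove : Move → Config → Config
applyMove (split i j)   = splitAt i j
applyMove (unsplit i j) = unsplitAt i j

run : List Move → Config
run []       = zeroConfig
run (m ∷ ms) = applyMove m (run ms)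

Outcome : ℕ → Config → Set
Outcome d w = ∃ λ (ms : List Move) → All (MoveIn d) ms × (∀ x y → run ms x y ≡ w x y)

V : ℕ → List (ℕ × ℕ)
V d = concatMap (λ k → map (λ i → (i , k ℕ.∸ i)) (upTo (suc k))) (upTo (suc d))

suppPos : ℕ → Config → List (ℕ × ℕ)
suppPos d w = filter (λ p → ℤ.+ 0 ℤ.<? w (Data.Product.proj₁ p) (Data.Product.proj₂ p)) (V d)

Valid : Config → Set
Valid w = ∀ i j → (i , j) ≢ (0 , 0) → + 0 ℤ.≤ w i j

DegLe : Config → ℕ → Set
DegLe w n = ∀ i j → w i j ≢ + 0 → i +ℕ j ≤ n

-- For k ≥ 1 let E_k(w) = ∑ w(i , j) [t^k] t^i (1 - t)^j, and let F_k be the same with i and j exchanged.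
-- As t^i (1 - t)^j = t^(i+1) (1 - t)^j + t^i (1 - t)^(j+1), no move changes E_k or F_k, so both vanish on
-- every outcome. The origin contributes nothing for k ≥ 1 and every other nonzero entry of a valid
-- outcome is positive, so the four points of supp⁺(w) with their positive weights satisfy E_k = F_k = 0
-- for all k ≥ 1. These equations force a point (0 , j) with j ≥ 1, a point in column 1 and a point
-- (i , 0) with i ≥ 1. Capping coordinates at 7 leaves finitely many configurations, and evaluation
-- shows that each one containing a point of degree ≥ 6 violates an equation for one of three reasons:
-- some moment has terms of one sign only; the lowest column beyond a diagonal that no point reaches
-- carries a positive moment; or exactly two points carry three consecutive moments, which forces equal
-- ratios of consecutive binomials, hence equal offsets and then equal signs where opposite ones are needed.

module Submission where

open import Defs
open import Data.Bool using (Bool; true; false; not; _∧_; _∨_; T; if_then_else_)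
open import Data.Bool.ListAction using (all; any; or)
open import Data.Bool.Properties using (T-≡; T-∧; T-∨; T?; not-¬)
open import Data.Empty using (⊥; ⊥-elim)
open import Data.Integer as ℤ using (ℤ; +_; -_; +[1+_]) renaming (_+_ to _+ℤ_; _*_ to _*ℤ_; _-_ to _-ℤ_)
import Data.Integer.Properties as ℤ
open import Data.Integer.Tactic.RingSolver using (solve-∀)
open import Data.List
  using (List; []; _∷_; _++_; map; length; filter; filterᵇ; concatMap; upTo; applyUpTo; cartesianProduct)
open import Data.List.Properties using (length-map; map-cong; map-cong-local)
open import Data.List.Membership.Propositional using (_∈_; find; lose)
open import Data.List.Membership.Propositional.Properties
  using (∈-∃++; ∈-filter⁺; ∈-concatMap⁺; ∈-map⁺; ∈-upTo⁺; ∈-applyUpTo⁺; ∈-cartesianProduct⁺)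
open import Data.List.Relation.Binary.Permutation.Propositional as ↭ using (_↭_; prep; ↭-refl; ↭-trans)
open import Data.List.Relation.Binary.Permutation.Propositional.Properties using (shift; ∈-resp-↭; ↭-length; map⁺)
open import Data.List.Relation.Unary.All as All using (All; []; _∷_)
import Data.List.Relation.Unary.All.Properties as All
open import Data.List.Relation.Unary.Any as Any using (Any; here; there; any?)
import Data.List.Relation.Unary.Any.Properties as Any
open import Data.Nat using (ℕ; zero; suc; _+_; _*_; _∸_; _≤_; _<_; _⊓_; z≤n; s≤s; _≤ᵇ_; _<ᵇ_; _≡ᵇ_; _<?_; >-nonZero)
open import Data.Nat.Induction using (<-rec)
open import Data.Nat.Properties
import Data.Nat.Tactic.RingSolver as ℕ
open import Data.Product using (_×_; _,_; proj₁; proj₂; ∃; ∃₂; uncurry)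
open import Data.Sum using (_⊎_; inj₁; inj₂)
open import Function using (_∘_; id; Equivalence)
open import Relation.Binary.Definitions using (Tri; tri<; tri≈; tri>)
open import Relation.Binary.PropositionalEquality
open import Relation.Nullary using (¬_; yes; no; contradiction)
open import Relation.Nullary.Decidable using (_×-dec_)
open import Relation.Unary using (Decidable)
open ≡-Reasoning

-- Coefficients of t^i (1 - t)^j

binomial : ℕ → ℕ → ℕ
binomial n       zero    = 1
binomial zero    (suc r) = 0
binomial (suc n) (suc r) = binomial n r + binomial n (suc r)

binomial-pos : ∀ {n r} → r ≤ n → 0 < binomial n r
binomial-pos {r = zero}  _         = s≤s z≤n
binomial-pos {suc n} {suc r} (s≤s r≤n) = ≤-trans (binomial-pos r≤n) (m≤m+n _ _)

binomial-zero : ∀ {n r} → n < r → binomial n r ≡ 0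
binomial-zero {zero}  {suc r} _         = refl
binomial-zero {suc n} {suc r} (s≤s n<r)
  rewrite binomial-zero n<r | binomial-zero (m<n⇒m<1+n n<r) = refl

binomial-ratio : ∀ n r → binomial n (suc r) * suc r ≡ binomial n r * (n ∸ r)
binomial-ratio zero    zero    = refl
binomial-ratio zero    (suc r) = refl
binomial-ratio (suc n) zero    = begin
  (1 + binomial n 1) * 1  ≡⟨ *-identityʳ _ ⟩
  1 + binomial n 1        ≡⟨ cong suc (trans (sym (*-identityʳ _)) (binomial-ratio n 0)) ⟩
  1 + 1 * n               ≡⟨ cong suc (*-identityˡ n) ⟩
  suc n                   ≡⟨ sym (*-identityˡ (suc n)) ⟩
  1 * suc n               ∎
binomial-ratio (suc n) (suc r) = begin
  (C r′ + C r″) * (2 + r)                  ≡⟨ *-distribʳ-+ (2 + r) (C r′) (C r″) ⟩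
  C r′ * (2 + r) + C r″ * (2 + r)          ≡⟨ cong (λ m → C r′ * (2 + r) + m) (binomial-ratio n r′) ⟩
  C r′ * (2 + r) + C r′ * (n ∸ r′)         ≡⟨ sym (*-distribˡ-+ (C r′) (2 + r) (n ∸ r′)) ⟩
  C r′ * (2 + r + (n ∸ r′))                ≡⟨ by-trichotomy (<-cmp r n) ⟩
  C r * (n ∸ r) + C r′ * (n ∸ r)           ≡⟨ sym (*-distribʳ-+ (n ∸ r) (C r) (C r′)) ⟩
  (C r + C r′) * (n ∸ r)                   ∎
  where
  C : ℕ → ℕ
  C = binomial n
  r′ r″ : ℕ
  r′ = suc r
  r″ = suc r′
  by-trichotomy : Tri (r < n) (r ≡ n) (n < r) → C r′ * (2 + r + (n ∸ r′)) ≡ C r * (n ∸ r) + C r′ * (n ∸ r)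
  by-trichotomy (tri< r<n _ _) = begin
    C r′ * (2 + r + (n ∸ r′))         ≡⟨ cong (λ m → C r′ * suc m) (trans (m+[n∸m]≡n r<n) (sym (m+[n∸m]≡n (<⇒≤ r<n)))) ⟩
    C r′ * (r′ + (n ∸ r))             ≡⟨ *-distribˡ-+ (C r′) r′ (n ∸ r) ⟩
    C r′ * r′ + C r′ * (n ∸ r)        ≡⟨ cong (_+ C r′ * (n ∸ r)) (binomial-ratio n r) ⟩
    C r * (n ∸ r) + C r′ * (n ∸ r)    ∎
  by-trichotomy (tri≈ _ refl _) rewrite binomial-zero (n<1+n n) | n∸n≡0 n | *-zeroʳ (C n) = refl
  by-trichotomy (tri> _ _ n<r) rewrite binomial-zero (m<n⇒m<1+n n<r) | binomial-zero n<r = refl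

even : ℕ → Bool
even zero    = true
even (suc n) = not (even n)

alternate : ℕ → ℤ → ℤ
alternate zero    x = x
alternate (suc r) x = - alternate r x

alternate-+ : ∀ r x y → alternate r (x +ℤ y) ≡ alternate r x +ℤ alternate r y
alternate-+ zero    x y = refl
alternate-+ (suc r) x y = trans (cong -_ (alternate-+ r x y)) (ℤ.neg-distrib-+ (alternate r x) (alternate r y))

alternate-* : ∀ r z x → z *ℤ alternate r x ≡ alternate r (z *ℤ x)
alternate-* zero    z x = refl
alternate-* (suc r) z x = trans (sym (ℤ.neg-distribʳ-* z (alternate r x))) (cong -_ (alternate-* r z x))

alternate-0 : ∀ r → alternate r (+ 0) ≡ + 0
alternate-0 zero    = refl
alternate-0 (suc r) = cong -_ (alternate-0 r)

alternate-even : ∀ r x → even r ≡ true → alternate r x ≡ x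
alternate-odd  : ∀ r x → even r ≡ false → alternate r x ≡ - x
alternate-even zero    x _ = refl
alternate-even (suc r) x e with even r in e′
alternate-even (suc r) x () | true
... | false = trans (cong -_ (alternate-odd r x e′)) (ℤ.neg-involutive x)
alternate-odd (suc r) x e with even r in e′
alternate-odd (suc r) x () | false
... | true = cong -_ (alternate-even r x e′)

-- coeff k i j is the coefficient of t^k in t^i (1 - t)^j.
coeff : ℕ → ℕ → ℕ → ℤ
coeff k       zero    j = alternate k (+ binomial j k)
coeff zero    (suc i) j = + 0
coeff (suc k) (suc i) j = coeff k i j

coeff-pascal : ∀ k i j → coeff k i j ≡ coeff k (suc i) j +ℤ coeff k i (suc j)
coeff-pascal zero    zero    j = refl
coeff-pascal (suc k) zero    j = begin
  - A                     ≡⟨ sym (cancel A B) ⟩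
  B +ℤ - (B +ℤ A)         ≡⟨ cong (λ z → B +ℤ - z) (sym (alternate-+ k (+ binomial j k) (+ binomial j (suc k)))) ⟩
  B +ℤ - alternate k (+ (binomial j k + binomial j (suc k))) ∎
  where
  A B : ℤ
  A = alternate k (+ binomial j (suc k))
  B = alternate k (+ binomial j k)
  cancel : ∀ a b → b +ℤ - (b +ℤ a) ≡ - a
  cancel = solve-∀
coeff-pascal zero    (suc i) j = refl
coeff-pascal (suc k) (suc i) j = coeff-pascal k i j

coeff-at : ∀ i r j {k} → i + r ≡ k → coeff k i j ≡ alternate r (+ binomial j r)
coeff-at zero    r j refl = refl
coeff-at (suc i) r j refl = coeff-at i r j refl

coeff-below : ∀ {k i} j → k < i → coeff k i j ≡ + 0
coeff-below {zero}  {suc i} j _         = refl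
coeff-below {suc k} {suc i} j (s≤s k<i) = coeff-below j k<i

-- Finite sums and invariance under moves

∑ : {A : Set} → List A → (A → ℤ) → ℤ
∑ []       f = + 0
∑ (x ∷ xs) f = f x +ℤ ∑ xs f

∑-++ : {A : Set} (xs ys : List A) (f : A → ℤ) → ∑ (xs ++ ys) f ≡ ∑ xs f +ℤ ∑ ys f
∑-++ []       ys f = sym (ℤ.+-identityˡ _)
∑-++ (x ∷ xs) ys f = trans (cong (f x +ℤ_) (∑-++ xs ys f)) (sym (ℤ.+-assoc (f x) _ _))

∑-concatMap : {A B : Set} (g : A → List B) (xs : List A) (f : B → ℤ) →
  ∑ (concatMap g xs) f ≡ ∑ xs (λ x → ∑ (g x) f)
∑-concatMap g []       f = refl
∑-concatMap g (x ∷ xs) f = trans (∑-++ (g x) _ f) (cong (∑ (g x) f +ℤ_) (∑-concatMap g xs f))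

∑-map : {A B : Set} (g : A → B) (xs : List A) (f : B → ℤ) → ∑ (map g xs) f ≡ ∑ xs (f ∘ g)
∑-map g []       f = refl
∑-map g (x ∷ xs) f = cong (f (g x) +ℤ_) (∑-map g xs f)

∑-cong : {A : Set} (xs : List A) {f g : A → ℤ} → (∀ x → f x ≡ g x) → ∑ xs f ≡ ∑ xs g
∑-cong []       eq = refl
∑-cong (x ∷ xs) eq = cong₂ _+ℤ_ (eq x) (∑-cong xs eq)

∑-+ : {A : Set} (xs : List A) (f g : A → ℤ) → ∑ xs (λ x → f x +ℤ g x) ≡ ∑ xs f +ℤ ∑ xs g
∑-+ []       f g = refl
∑-+ (x ∷ xs) f g = trans (cong (f x +ℤ g x +ℤ_) (∑-+ xs f g)) (interchange (f x) (g x) _ _)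
  where
  interchange : ∀ a b c d → (a +ℤ b) +ℤ (c +ℤ d) ≡ (a +ℤ c) +ℤ (b +ℤ d)
  interchange = solve-∀

∑-neg : {A : Set} (xs : List A) (f : A → ℤ) → ∑ xs (λ x → - f x) ≡ - ∑ xs f
∑-neg []       f = refl
∑-neg (x ∷ xs) f = trans (cong (- f x +ℤ_) (∑-neg xs f)) (sym (ℤ.neg-distrib-+ (f x) (∑ xs f)))

∑-zero : {A : Set} (xs : List A) {f : A → ℤ} → (∀ x → f x ≡ + 0) → ∑ xs f ≡ + 0
∑-zero []       z = refl
∑-zero (x ∷ xs) z rewrite z x = trans (ℤ.+-identityˡ _) (∑-zero xs z)

∑-filter : {A : Set} {P : A → Set} (P? : Decidable P) (xs : List A) {f : A → ℤ} →
           (∀ x → ¬ P x → f x ≡ + 0) → ∑ (filter P? xs) f ≡ ∑ xs f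
∑-filter P? []       off = refl
∑-filter P? (x ∷ xs) {f} off with P? x
... | yes _  = cong (f x +ℤ_) (∑-filter P? xs off)
... | no ¬px = trans (∑-filter P? xs off) (sym (trans (cong (_+ℤ ∑ xs f) (off x ¬px)) (ℤ.+-identityˡ _)))

∑-applyUpTo-zero : ∀ n (h : ℕ → ℕ) (f : ℕ → ℤ) → (∀ x → x < n → f (h x) ≡ + 0) → ∑ (applyUpTo h n) f ≡ + 0
∑-applyUpTo-zero zero    h f z = refl
∑-applyUpTo-zero (suc n) h f z
  rewrite z 0 (s≤s z≤n) | ∑-applyUpTo-zero n (h ∘ suc) f (λ x x<n → z (suc x) (s≤s x<n)) = refl

∑-applyUpTo-single : ∀ n (h : ℕ → ℕ) (f : ℕ → ℤ) x₀ → x₀ < n →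
  (∀ x → x < n → x ≢ x₀ → f (h x) ≡ + 0) → ∑ (applyUpTo h n) f ≡ f (h x₀)
∑-applyUpTo-single (suc n) h f zero _ z
  rewrite ∑-applyUpTo-zero n (h ∘ suc) f (λ x x<n → z (suc x) (s≤s x<n) (λ ())) = ℤ.+-identityʳ _
∑-applyUpTo-single (suc n) h f (suc x₀) (s≤s x₀<n) z rewrite z 0 (s≤s z≤n) (λ ()) =
  trans (ℤ.+-identityˡ _)
    (∑-applyUpTo-single n (h ∘ suc) f x₀ x₀<n (λ x x<n x≢x₀ → z (suc x) (s≤s x<n) (x≢x₀ ∘ suc-injective)))

infixl 6 _⊕_ _⊖_

_⊕_ _⊖_ : Config → Config → Config
(u ⊕ v) x y = u x y +ℤ v x y
(u ⊖ v) x y = u x y -ℤ v x y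

chip : ℕ → ℕ → Config
chip a b x y = ind (at a b x y)

chip-self : ∀ a b → chip a b a b ≡ + 1
chip-self a b with a ≟ a | b ≟ b
... | yes _ | yes _   = refl
... | no a≢a | _      = contradiction refl a≢a
... | yes _ | no b≢b  = contradiction refl b≢b

chip-elsewhere : ∀ {a b x y} → ¬ (x ≡ a × y ≡ b) → chip a b x y ≡ + 0
chip-elsewhere {a} {b} {x} {y} ne with x ≟ a | y ≟ b
... | yes x≡a | yes y≡b = contradiction (x≡a , y≡b) ne
... | yes _   | no _    = refl
... | no _    | _       = refl

-- pairing d (coeff k) w is E_k(w).
pairing : ℕ → (ℕ → ℕ → ℤ) → Config → ℤ
pairing d g w = ∑ (V d) (λ p → w (proj₁ p) (proj₂ p) *ℤ g (proj₁ p) (proj₂ p))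

pairing-⊕ : ∀ d g u v → pairing d g (u ⊕ v) ≡ pairing d g u +ℤ pairing d g v
pairing-⊕ d g u v = trans (∑-cong (V d) (λ p → ℤ.*-distribʳ-+ (g (proj₁ p) (proj₂ p)) (u (proj₁ p) (proj₂ p)) _))
                           (∑-+ (V d) (λ p → u (proj₁ p) (proj₂ p) *ℤ g (proj₁ p) (proj₂ p)) _)

pairing-⊖ : ∀ d g u v → pairing d g (u ⊖ v) ≡ pairing d g u -ℤ pairing d g v
pairing-⊖ d g u v = begin
  pairing d g (u ⊖ v)                                  ≡⟨ ∑-cong (V d) (λ p → distrib (u (proj₁ p) (proj₂ p)) (v (proj₁ p) (proj₂ p)) _) ⟩
  ∑ (V d) (λ p → U p +ℤ - W p)                         ≡⟨ ∑-+ (V d) U (λ p → - W p) ⟩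
  pairing d g u +ℤ ∑ (V d) (λ p → - W p)               ≡⟨ cong (pairing d g u +ℤ_) (∑-neg (V d) W) ⟩
  pairing d g u -ℤ pairing d g v                       ∎
  where
  U W : ℕ × ℕ → ℤ
  U p = u (proj₁ p) (proj₂ p) *ℤ g (proj₁ p) (proj₂ p)
  W p = v (proj₁ p) (proj₂ p) *ℤ g (proj₁ p) (proj₂ p)
  distrib : ∀ a b c → (a -ℤ b) *ℤ c ≡ a *ℤ c +ℤ - (b *ℤ c)
  distrib = solve-∀

cell : ℕ → ℕ → ℕ × ℕ
cell k i = i , k ∸ i

diagonal : ℕ → List (ℕ × ℕ)
diagonal k = map (cell k) (upTo (suc k))

pairing-chip : ∀ {d} a b g → a + b ≤ d → pairing d g (chip a b) ≡ g a b
pairing-chip {d} a b g a+b≤d = begin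
  ∑ (V d) F                                                ≡⟨ ∑-concatMap diagonal (upTo (suc d)) F ⟩
  ∑ (upTo (suc d)) (λ k → ∑ (diagonal k) F)                ≡⟨ ∑-cong (upTo (suc d)) (λ k → ∑-map (cell k) (upTo (suc k)) F) ⟩
  ∑ (upTo (suc d)) (λ k → ∑ (upTo (suc k)) (F ∘ cell k))   ≡⟨ ∑-applyUpTo-single (suc d) id _ (a + b) (s≤s a+b≤d) off-diagonal ⟩
  ∑ (upTo (suc (a + b))) (F ∘ cell (a + b))                ≡⟨ ∑-applyUpTo-single (suc (a + b)) id _ a (s≤s (m≤m+n a b)) off-column ⟩
  F (a , a + b ∸ a)                                        ≡⟨ cong (λ z → chip a b a z *ℤ g a z) (m+n∸m≡n a b) ⟩
  chip a b a b *ℤ g a b                                    ≡⟨ cong (_*ℤ g a b) (chip-self a b) ⟩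
  + 1 *ℤ g a b                                             ≡⟨ ℤ.*-identityˡ (g a b) ⟩
  g a b                                                    ∎
  where
  F : ℕ × ℕ → ℤ
  F p = chip a b (proj₁ p) (proj₂ p) *ℤ g (proj₁ p) (proj₂ p)
  F-elsewhere : ∀ {x y} → ¬ (x ≡ a × y ≡ b) → F (x , y) ≡ + 0
  F-elsewhere ne = cong (_*ℤ _) (chip-elsewhere ne)
  off-column : ∀ i → i < suc (a + b) → i ≢ a → F (cell (a + b) i) ≡ + 0
  off-column i _ i≢a = F-elsewhere (i≢a ∘ proj₁)
  off-diagonal : ∀ k → k < suc d → k ≢ a + b → ∑ (upTo (suc k)) (F ∘ cell k) ≡ + 0
  off-diagonal k _ k≢a+b = ∑-applyUpTo-zero (suc k) id (F ∘ cell k) λ where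
    i (s≤s i≤k) → F-elsewhere {i} {k ∸ i} λ where
      (refl , k∸a≡b) → k≢a+b (trans (sym (m+[n∸m]≡n i≤k)) (cong (λ z → i + z) k∸a≡b))

IsPascal : (ℕ → ℕ → ℤ) → Set
IsPascal g = ∀ i j → g i j ≡ g (suc i) j +ℤ g i (suc j)

pairing-move : ∀ {d} g → IsPascal g → ∀ m w → MoveIn d m → pairing d g (applyMove m w) ≡ pairing d g w
pairing-move {d} g pascal (split i j) w i+j<d = begin
  pairing d g (w ⊖ c₀ ⊕ c₁ ⊕ c₂)
    ≡⟨ trans (pairing-⊕ d g (w ⊖ c₀ ⊕ c₁) c₂) (cong₂ _+ℤ_
         (trans (pairing-⊕ d g (w ⊖ c₀) c₁) (cong₂ _+ℤ_
           (trans (pairing-⊖ d g w c₀) (cong (pairing d g w -ℤ_) (pairing-chip i j g (<⇒≤ i+j<d))))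
           (pairing-chip (suc i) j g i+j<d)))
         (pairing-chip i (suc j) g (≤-trans (≤-reflexive (+-suc i j)) i+j<d))) ⟩
  pairing d g w -ℤ g i j +ℤ g (suc i) j +ℤ g i (suc j)
    ≡⟨ cong (λ z → pairing d g w -ℤ z +ℤ g (suc i) j +ℤ g i (suc j)) (pascal i j) ⟩
  pairing d g w -ℤ (g (suc i) j +ℤ g i (suc j)) +ℤ g (suc i) j +ℤ g i (suc j)
    ≡⟨ cancel (pairing d g w) (g (suc i) j) (g i (suc j)) ⟩
  pairing d g w ∎
  where
  c₀ c₁ c₂ : Config
  c₀ = chip i j
  c₁ = chip (suc i) j
  c₂ = chip i (suc j)
  cancel : ∀ p a b → p -ℤ (a +ℤ b) +ℤ a +ℤ b ≡ p
  cancel = solve-∀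
pairing-move {d} g pascal (unsplit i j) w i+j<d = begin
  pairing d g (w ⊕ c₀ ⊖ c₁ ⊖ c₂)
    ≡⟨ trans (pairing-⊖ d g (w ⊕ c₀ ⊖ c₁) c₂) (cong₂ _-ℤ_
         (trans (pairing-⊖ d g (w ⊕ c₀) c₁) (cong₂ _-ℤ_
           (trans (pairing-⊕ d g w c₀) (cong (pairing d g w +ℤ_) (pairing-chip i j g (<⇒≤ i+j<d))))
           (pairing-chip (suc i) j g i+j<d)))
         (pairing-chip i (suc j) g (≤-trans (≤-reflexive (+-suc i j)) i+j<d))) ⟩
  pairing d g w +ℤ g i j -ℤ g (suc i) j -ℤ g i (suc j)
    ≡⟨ cong (λ z → pairing d g w +ℤ z -ℤ g (suc i) j -ℤ g i (suc j)) (pascal i j) ⟩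
  pairing d g w +ℤ (g (suc i) j +ℤ g i (suc j)) -ℤ g (suc i) j -ℤ g i (suc j)
    ≡⟨ cancel (pairing d g w) (g (suc i) j) (g i (suc j)) ⟩
  pairing d g w ∎
  where
  c₀ c₁ c₂ : Config
  c₀ = chip i j
  c₁ = chip (suc i) j
  c₂ = chip i (suc j)
  cancel : ∀ p a b → p +ℤ (a +ℤ b) -ℤ a -ℤ b ≡ p
  cancel = solve-∀

pairing-outcome : ∀ {d} g → IsPascal g → ∀ w → Outcome d w → pairing d g w ≡ + 0
pairing-outcome {d} g pascal w (ms , ms∈ , run≡w) =
  trans (∑-cong (V d) (λ p → cong (_*ℤ g (proj₁ p) (proj₂ p)) (sym (run≡w (proj₁ p) (proj₂ p))))) (pairing-run ms ms∈)
  where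
  pairing-run : ∀ ms → All (MoveIn d) ms → pairing d g (run ms) ≡ + 0
  pairing-run []       []         = ∑-zero (V d) (λ _ → refl)
  pairing-run (m ∷ ms) (m∈ ∷ ms∈) = trans (pairing-move g pascal m (run ms) m∈) (pairing-run ms ms∈)

-- (a , i , j) stands for the weight 1 + a at the point (i , j).
WeightedPoint : Set
WeightedPoint = ℕ × ℕ × ℕ

point : WeightedPoint → ℕ × ℕ
point (_ , i , j) = i , j

column row degree : WeightedPoint → ℕ
column (_ , i , _) = i
row    (_ , _ , j) = j
degree (_ , i , j) = i + j

Coefficients : Set
Coefficients = ℕ → ℕ → ℕ → ℤ

moment : Coefficients → ℕ → List WeightedPoint → ℤ
moment g k []              = + 0
moment g k ((a , i , j) ∷ xs) = + suc a *ℤ g k i j +ℤ moment g k xs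

Balanced : Coefficients → List WeightedPoint → Set
Balanced g xs = ∀ k → 1 ≤ k → moment g k xs ≡ + 0

coeffᵀ : Coefficients
coeffᵀ k i j = coeff k j i

negated : Coefficients → Coefficients
negated g k i j = - g k i j

moment-negated : ∀ g k xs → moment (negated g) k xs ≡ - moment g k xs
moment-negated g k []                 = refl
moment-negated g k ((a , i , j) ∷ xs) = begin
  + suc a *ℤ - g k i j +ℤ moment (negated g) k xs
    ≡⟨ cong₂ _+ℤ_ (sym (ℤ.neg-distribʳ-* (+ suc a) (g k i j))) (moment-negated g k xs) ⟩
  - (+ suc a *ℤ g k i j) +ℤ - moment g k xs
    ≡⟨ sym (ℤ.neg-distrib-+ (+ suc a *ℤ g k i j) (moment g k xs)) ⟩
  - (+ suc a *ℤ g k i j +ℤ moment g k xs) ∎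

valueAt : Coefficients → ℕ → WeightedPoint → ℤ
valueAt g k (_ , i , j) = g k i j

NonNegativeAt PositiveAt : Coefficients → ℕ → WeightedPoint → Set
NonNegativeAt g k x = ∃ λ n → valueAt g k x ≡ + n
PositiveAt    g k x = ∃ λ n → valueAt g k x ≡ + suc n

moment-nonNegative : ∀ g k xs → All (NonNegativeAt g k) xs → ∃ λ n → moment g k xs ≡ + n
moment-nonNegative g k []                 []             = 0 , refl
moment-nonNegative g k ((a , i , j) ∷ xs) ((n , e) ∷ ps) with moment-nonNegative g k xs ps
... | m , e′ = suc a * n + m , (begin
  + suc a *ℤ g k i j +ℤ moment g k xs ≡⟨ cong₂ (λ u v → + suc a *ℤ u +ℤ v) e e′ ⟩
  + suc a *ℤ + n +ℤ + m              ≡⟨ cong (_+ℤ + m) (sym (ℤ.pos-* (suc a) n)) ⟩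
  + (suc a * n + m)                   ∎)

moment-positive : ∀ g k xs → All (NonNegativeAt g k) xs → Any (PositiveAt g k) xs → ∃ λ n → moment g k xs ≡ + suc n
moment-positive g k ((a , i , j) ∷ xs) (_ ∷ ps) (here (n , e)) with moment-nonNegative g k xs ps
... | m , e′ = n + a * suc n + m , cong₂ (λ u v → + suc a *ℤ u +ℤ v) e e′
moment-positive g k ((a , i , j) ∷ xs) ((n , e) ∷ ps) (there p) with moment-positive g k xs ps p
... | m , e′ = suc a * n + m , (begin
  + suc a *ℤ g k i j +ℤ moment g k xs ≡⟨ cong₂ (λ u v → + suc a *ℤ u +ℤ v) e e′ ⟩
  + suc a *ℤ + n +ℤ + suc m          ≡⟨ cong (_+ℤ + suc m) (sym (ℤ.pos-* (suc a) n)) ⟩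
  + (suc a * n + suc m)               ≡⟨ cong +_ (+-suc (suc a * n) m) ⟩
  + suc (suc a * n + m)               ∎)

moment≢0 : ∀ g k xs → All (NonNegativeAt g k) xs → Any (PositiveAt g k) xs → moment g k xs ≢ + 0
moment≢0 g k xs ps p eq with moment-positive g k xs ps p
... | n , e with trans (sym e) eq
... | ()

-- Decidable tests on point sets

T-∧⁻ : ∀ a {b} → T (a ∧ b) → T a × T b
T-∧⁻ a = Equivalence.to (T-∧ {a})

T-∨⁻ : ∀ a {b} → T (a ∨ b) → T a ⊎ T b
T-∨⁻ a = Equivalence.to (T-∨ {a})

≰ᵇ⇒> : ∀ {m n} → ¬ T (m ≤ᵇ n) → n < m
≰ᵇ⇒> m≰ᵇn = ≰⇒> (m≰ᵇn ∘ ≤⇒≤ᵇ)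

covers : ℕ → ℕ × ℕ → Bool
covers k (i , j) = (i ≤ᵇ k) ∧ (k ≤ᵇ i + j)

covers⇒ : ∀ k i j → T (covers k (i , j)) → i ≤ k × k ≤ i + j
covers⇒ k i j c = let i≤ᵇk , k≤ᵇi+j = T-∧⁻ (i ≤ᵇ k) c in ≤ᵇ⇒≤ i k i≤ᵇk , ≤ᵇ⇒≤ k (i + j) k≤ᵇi+j

uncovered⇒ : ∀ k i j → ¬ T (covers k (i , j)) → i ≤ k → i + j < k
uncovered⇒ k i j ¬c i≤k = ≰ᵇ⇒> (λ k≤ᵇi+j → ¬c (Equivalence.from T-∧ (≤⇒≤ᵇ i≤k , k≤ᵇi+j)))

coeff-covered : ∀ {k i} j → i ≤ k → coeff k i j ≡ alternate (k ∸ i) (+ binomial j (k ∸ i))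
coeff-covered {k} {i} j i≤k = coeff-at i (k ∸ i) j (m+[n∸m]≡n i≤k)

coeff-uncovered : ∀ k i j → ¬ T (covers k (i , j)) → coeff k i j ≡ + 0
coeff-uncovered k i j ¬c with ≤-<-connex i k
... | inj₂ k<i = coeff-below j k<i
... | inj₁ i≤k = begin
  coeff k i j                              ≡⟨ coeff-covered j i≤k ⟩
  alternate (k ∸ i) (+ binomial j (k ∸ i)) ≡⟨ cong (alternate (k ∸ i) ∘ +_) (binomial-zero j<k∸i) ⟩
  alternate (k ∸ i) (+ 0)                  ≡⟨ alternate-0 (k ∸ i) ⟩
  + 0                                      ∎
  where
  i+j<k : i + j < k
  i+j<k = uncovered⇒ k i j ¬c i≤k
  j<k∸i : j < k ∸ i
  j<k∸i = +-cancelˡ-< i j (k ∸ i) (subst (i + j <_) (sym (m+[n∸m]≡n i≤k)) i+j<k)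

coeff-covered-sign : ∀ k i j → T (covers k (i , j)) → ∃ λ n → coeff k i j ≡ alternate (k ∸ i) (+ suc n)
coeff-covered-sign k i j c with covers⇒ k i j c
... | i≤k , k≤i+j
  with binomial j (k ∸ i) | binomial-pos {j} {k ∸ i} (m≤n+o⇒m∸n≤o k i k≤i+j) | coeff-covered {k} {i} j i≤k
... | suc n | _ | e = n , e

coeff-beyond-degree : ∀ k i j → i + j < k → coeff k i j ≡ + 0
coeff-beyond-degree k i j i+j<k = coeff-uncovered k i j (λ c → <⇒≱ i+j<k (proj₂ (covers⇒ k i j c)))

data Side : Set where
  direct transposed : Side

orient : Side → ℕ × ℕ → ℕ × ℕ
orient direct     p       = p
orient transposed (i , j) = j , i

data Feature : Set where
  positiveAt negativeAt covering beyond coveringAll3 coveringPartly3 : ℕ → Feature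
  highDegree : Feature

holds : Feature → ℕ × ℕ → Bool
holds (positiveAt k)      (i , j) = covers k (i , j) ∧ even (k ∸ i)
holds (negativeAt k)      (i , j) = covers k (i , j) ∧ not (even (k ∸ i))
holds (covering k)        p       = covers k p
holds (beyond k)          (i , _) = k <ᵇ i
holds (coveringAll3 k)    p       = covers k p ∧ (covers (suc k) p ∧ covers (suc (suc k)) p)
holds (coveringPartly3 k) p       = (covers k p ∨ (covers (suc k) p ∨ covers (suc (suc k)) p))
                                    ∧ not (holds (coveringAll3 k) p)
holds highDegree          (i , j) = 6 ≤ᵇ i + j

count : Side → Feature → List (ℕ × ℕ) → ℕ
count s f []       = 0
count s f (p ∷ ps) = if holds f (orient s p) then suc (count s f ps) else count s f ps

counts : Side → List (ℕ × ℕ) → Feature → ℕ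
counts s ps f = count s f ps

data Test : Set where
  signTest gapTest pairTest : ℕ → Test

-- Each test, read on side direct or transposed, contradicts E = 0 or F = 0 respectively.
-- signTest k: all nonzero terms of the k-th moment have the same sign;
-- gapTest k: no point covers diagonal k, yet some point lies in a column beyond k;
-- pairTest k: exactly two points cover one of the diagonals k, k + 1, k + 2, and both cover all three.
passes : Test → (Feature → ℕ) → Bool
passes (signTest k) c = ((0 <ᵇ c (positiveAt k)) ∧ (c (negativeAt k) ≡ᵇ 0))
                      ∨ ((0 <ᵇ c (negativeAt k)) ∧ (c (positiveAt k) ≡ᵇ 0))
passes (gapTest k)  c = (c (covering k) ≡ᵇ 0) ∧ (0 <ᵇ c (beyond k))
passes (pairTest k) c = (c (coveringAll3 k) ≡ᵇ 2) ∧ (c (coveringPartly3 k) ≡ᵇ 0)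

level : Test → ℕ
level (signTest k) = k
level (gapTest k)  = k
level (pairTest k) = k

-- Together these refute every enumerated configuration that contains a point of degree ≥ 6.
tests : List (Side × Test)
tests = (transposed , signTest 1) ∷ (direct , signTest 1) ∷ (direct , signTest 2) ∷ (transposed , signTest 2) ∷
        (direct , signTest 3) ∷ (transposed , signTest 3) ∷ (direct , signTest 4) ∷ (transposed , signTest 4) ∷
        (direct , signTest 5) ∷ (transposed , signTest 5) ∷ (direct , signTest 6) ∷ (transposed , signTest 6) ∷
        (direct , pairTest 1) ∷ (transposed , pairTest 1) ∷ (direct , pairTest 2) ∷ (transposed , pairTest 2) ∷
        (direct , pairTest 3) ∷ (transposed , pairTest 3) ∷ (direct , pairTest 4) ∷ (transposed , pairTest 4) ∷
        (direct , gapTest 1) ∷ (transposed , gapTest 1) ∷ (direct , gapTest 2) ∷ (transposed , gapTest 2) ∷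
        (direct , gapTest 3) ∷ (transposed , gapTest 3) ∷ (direct , gapTest 4) ∷ (transposed , gapTest 4) ∷
        (direct , gapTest 5) ∷ (transposed , gapTest 5) ∷ (direct , gapTest 6) ∷ (transposed , gapTest 6) ∷ []

runTest : List (ℕ × ℕ) → Side × Test → Bool
runTest ps (s , t) = passes t (counts s ps)

check : List (ℕ × ℕ) → Bool
check ps = (count direct highDegree ps ≡ᵇ 0) ∨ any (runTest ps) tests

positiveAt⇒ : ∀ k x → T (holds (positiveAt k) (point x)) → PositiveAt coeff k x
positiveAt⇒ k (_ , i , j) h with T-∧⁻ (covers k (i , j)) h
... | c , e with even (k ∸ i) in e′ | coeff-covered-sign k i j c
... | true | n , eq = n , trans eq (alternate-even (k ∸ i) _ e′)

negativeAt⇒ : ∀ k x → T (holds (negativeAt k) (point x)) → PositiveAt (negated coeff) k x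
negativeAt⇒ k (_ , i , j) h with T-∧⁻ (covers k (i , j)) h
... | c , e with even (k ∸ i) in e′ | coeff-covered-sign k i j c
... | false | n , eq = n , trans (cong -_ (trans eq (alternate-odd (k ∸ i) _ e′))) (ℤ.neg-involutive _)

¬negativeAt⇒ : ∀ k x → ¬ T (holds (negativeAt k) (point x)) → NonNegativeAt coeff k x
¬negativeAt⇒ k (_ , i , j) ¬h with T? (covers k (i , j))
... | no ¬c = 0 , coeff-uncovered k i j ¬c
... | yes c with even (k ∸ i) in e′ | coeff-covered-sign k i j c
...   | true  | n , eq = suc n , trans eq (alternate-even (k ∸ i) _ e′)
...   | false | _     = contradiction (Equivalence.from T-∧ (c , _)) ¬h

¬positiveAt⇒ : ∀ k x → ¬ T (holds (positiveAt k) (point x)) → NonNegativeAt (negated coeff) k x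
¬positiveAt⇒ k (_ , i , j) ¬h with T? (covers k (i , j))
... | no ¬c = 0 , cong -_ (coeff-uncovered k i j ¬c)
... | yes c with even (k ∸ i) in e′ | coeff-covered-sign k i j c
...   | false | n , eq = suc n , trans (cong -_ (trans eq (alternate-odd (k ∸ i) _ e′))) (ℤ.neg-involutive _)
...   | true  | _     = contradiction (Equivalence.from T-∧ (c , _)) ¬h

count-zero : ∀ f xs → count direct f (map point xs) ≡ 0 → All (λ x → ¬ T (holds f (point x))) xs
count-zero f []       _ = []
count-zero f ((_ , p) ∷ xs) #≡0 with holds f p in e
... | false = subst T e ∷ count-zero f xs #≡0

count-pos : ∀ f xs → 0 < count direct f (map point xs) → Any (λ x → T (holds f (point x))) xs
count-pos f ((_ , p) ∷ xs) 0<c with holds f p in e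
... | true  = here (subst T (sym e) _)
... | false = there (count-pos f xs 0<c)

moment-one-signed : ∀ g k xs P Q → moment g k xs ≡ + 0 →
  (∀ x → T (holds P (point x)) → PositiveAt g k x) → (∀ x → ¬ T (holds Q (point x)) → NonNegativeAt g k x) →
  0 < count direct P (map point xs) → count direct Q (map point xs) ≡ 0 → ⊥
moment-one-signed g k xs P Q eq pos nonNeg 0<#P #Q≡0 =
  moment≢0 g k xs (All.map (λ {x} → nonNeg x) (count-zero Q xs #Q≡0)) (Any.map (λ {x} → pos x) (count-pos P xs 0<#P)) eq

signTest-sound : ∀ xs k → Balanced coeff xs → 1 ≤ k → T (passes (signTest k) (counts direct (map point xs))) → ⊥
signTest-sound xs k balanced 1≤k t with T-∨⁻ ((0 <ᵇ count direct (positiveAt k) (map point xs)) ∧ _) t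
... | inj₁ t₁ =
  let 0<#+ , #-≡0 = T-∧⁻ (0 <ᵇ count direct (positiveAt k) (map point xs)) t₁ in
  moment-one-signed coeff k xs (positiveAt k) (negativeAt k) (balanced k 1≤k) (positiveAt⇒ k) (¬negativeAt⇒ k)
    (<ᵇ⇒< 0 _ 0<#+) (≡ᵇ⇒≡ _ 0 #-≡0)
... | inj₂ t₂ =
  let 0<#- , #+≡0 = T-∧⁻ (0 <ᵇ count direct (negativeAt k) (map point xs)) t₂ in
  moment-one-signed (negated coeff) k xs (negativeAt k) (positiveAt k)
    (trans (moment-negated coeff k xs) (cong -_ (balanced k 1≤k))) (negativeAt⇒ k) (¬positiveAt⇒ k)
    (<ᵇ⇒< 0 _ 0<#-) (≡ᵇ⇒≡ _ 0 #+≡0)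

-- The least column m > k occupied by a point: every point there contributes positively to moment m,
-- and nothing else contributes to it.
columns-bounded : ∀ k xs → Balanced coeff xs →
                  All (λ x → column x ≤ k → degree x ≤ k) xs → All (λ x → column x ≤ k) xs
columns-bounded k xs balanced low = All.tabulate (λ {x} x∈ → ≮⇒≥ (λ k<c → no-column-beyond (column x) k<c (lose x∈ refl)))
  where
  no-column-beyond : ∀ m → k < m → Any (λ x → column x ≡ m) xs → ⊥
  no-column-beyond = <-rec _ λ m IH k<m in-m →
    moment≢0 coeff m xs (All.tabulate (nonNeg m IH k<m)) (Any.map (λ {x} → positive {m} {x}) in-m)
      (balanced m (≤-trans (s≤s z≤n) k<m))
    where
    nonNeg : ∀ m → (∀ {m′} → m′ < m → k < m′ → Any (λ x → column x ≡ m′) xs → ⊥) → k < m →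
             ∀ {x} → x ∈ xs → NonNegativeAt coeff m x
    nonNeg m IH k<m {_ , i , j} x∈ with <-cmp i m
    ... | tri≈ _ refl _ = 1 , coeff-at i 0 j (+-identityʳ i)
    ... | tri> _ _ m<i  = 0 , coeff-below j m<i
    ... | tri< i<m _ _ with ≤-<-connex i k
    ...   | inj₂ k<i = ⊥-elim (IH i<m k<i (lose x∈ refl))
    ...   | inj₁ i≤k = 0 , coeff-beyond-degree m i j (≤-<-trans (All.lookup low x∈ i≤k) k<m)
    positive : ∀ {m x} → column x ≡ m → PositiveAt coeff m x
    positive {x = _ , i , j} refl = 0 , coeff-at i 0 j (+-identityʳ i)

gapTest-sound : ∀ xs k → Balanced coeff xs → T (passes (gapTest k) (counts direct (map point xs))) → ⊥
gapTest-sound xs k balanced t with T-∧⁻ (count direct (covering k) (map point xs) ≡ᵇ 0) t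
... | #≡0 , 0<# with find (count-pos (beyond k) xs (<ᵇ⇒< 0 _ 0<#))
... | (_ , i , _) , x∈ , k<ᵇi = <⇒≱ (<ᵇ⇒< k i k<ᵇi) (All.lookup (columns-bounded k xs balanced low) x∈)
  where
  low : All (λ x → column x ≤ k → degree x ≤ k) xs
  low = All.map (λ {x} → uncovered-low x) (count-zero (covering k) xs (≡ᵇ⇒≡ _ 0 #≡0))
    where
    uncovered-low : ∀ x → ¬ T (covers k (point x)) → column x ≤ k → degree x ≤ k
    uncovered-low (_ , i , j) ¬c i≤k = <⇒≤ (uncovered⇒ k i j ¬c i≤k)

two-terms-cancel : ∀ r r′ X Y → alternate r (+ X) +ℤ alternate r′ (+ Y) ≡ + 0 → 0 < X →
                   even r ≡ not (even r′) × X ≡ Y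
two-terms-cancel r r′ X Y eq 0<X with even r in e | even r′ in e′
... | true  | true
  rewrite alternate-even r (+ X) e | alternate-even r′ (+ Y) e′
  = contradiction (m+n≡0⇒m≡0 X (ℤ.+-injective eq)) (>⇒≢ 0<X)
... | false | false
  rewrite alternate-odd r (+ X) e | alternate-odd r′ (+ Y) e′
  = contradiction (m+n≡0⇒m≡0 X (ℤ.+-injective (ℤ.neg-injective (trans (ℤ.neg-distrib-+ (+ X) (+ Y)) eq)))) (>⇒≢ 0<X)
... | true  | false
  rewrite alternate-even r (+ X) e | alternate-odd r′ (+ Y) e′
  = refl , ℤ.+-injective (ℤ.i-j≡0⇒i≡j (+ X) (+ Y) eq)
... | false | true
  rewrite alternate-odd r (+ X) e | alternate-even r′ (+ Y) e′
  = refl , sym (ℤ.+-injective (ℤ.i-j≡0⇒i≡j (+ Y) (+ X) (trans (ℤ.+-comm (+ Y) (- + X)) eq)))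

binomial-cross : ∀ a b j₁ j₂ r₁ r₂ → 0 < a * binomial j₁ r₁ →
  a * binomial j₁ r₁ ≡ b * binomial j₂ r₂ → a * binomial j₁ (suc r₁) ≡ b * binomial j₂ (suc r₂) →
  (j₁ ∸ r₁) * suc r₂ ≡ (j₂ ∸ r₂) * suc r₁
binomial-cross a b j₁ j₂ r₁ r₂ pos e₀ e₁ = *-cancelˡ-≡ _ _ (a * binomial j₁ r₁) {{>-nonZero pos}} (begin
  (a * C₁ r₁) * ((j₁ ∸ r₁) * suc r₂)         ≡⟨ shuffle₁ a (C₁ r₁) (j₁ ∸ r₁) (suc r₂) ⟩
  (a * (C₁ r₁ * (j₁ ∸ r₁))) * suc r₂         ≡⟨ cong (λ z → (a * z) * suc r₂) (sym (binomial-ratio j₁ r₁)) ⟩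
  (a * (C₁ (suc r₁) * suc r₁)) * suc r₂      ≡⟨ shuffle₂ a (C₁ (suc r₁)) (suc r₁) (suc r₂) ⟩
  (a * C₁ (suc r₁)) * (suc r₁ * suc r₂)      ≡⟨ cong₂ _*_ e₁ (*-comm (suc r₁) (suc r₂)) ⟩
  (b * C₂ (suc r₂)) * (suc r₂ * suc r₁)      ≡⟨ sym (shuffle₂ b (C₂ (suc r₂)) (suc r₂) (suc r₁)) ⟩
  (b * (C₂ (suc r₂) * suc r₂)) * suc r₁      ≡⟨ cong (λ z → (b * z) * suc r₁) (binomial-ratio j₂ r₂) ⟩
  (b * (C₂ r₂ * (j₂ ∸ r₂))) * suc r₁         ≡⟨ sym (shuffle₁ b (C₂ r₂) (j₂ ∸ r₂) (suc r₁)) ⟩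
  (b * C₂ r₂) * ((j₂ ∸ r₂) * suc r₁)         ≡⟨ cong (_* ((j₂ ∸ r₂) * suc r₁)) (sym e₀) ⟩
  (a * C₁ r₁) * ((j₂ ∸ r₂) * suc r₁)         ∎)
  where
  C₁ C₂ : ℕ → ℕ
  C₁ = binomial j₁
  C₂ = binomial j₂
  shuffle₁ : ∀ a c u s → (a * c) * (u * s) ≡ (a * (c * u)) * s
  shuffle₁ = ℕ.solve-∀
  shuffle₂ : ∀ a c s t → (a * (c * s)) * t ≡ (a * c) * (s * t)
  shuffle₂ = ℕ.solve-∀

-- Subtracting the two equations leaves the linear relation r₂ + v₂ = r₁ + v₁.
ratios-sum : ∀ v₁ v₂ r₁ r₂ → (2 + v₁) * suc r₂ ≡ (2 + v₂) * suc r₁ → suc v₁ * (2 + r₂) ≡ suc v₂ * (2 + r₁) →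
             r₂ + v₂ ≡ r₁ + v₁
ratios-sum v₁ v₂ r₁ r₂ e₁ e₂ = +-cancelʳ-≡ K (r₂ + v₂) (r₁ + v₁) (begin
  r₂ + v₂ + K                                       ≡⟨ expand v₁ v₂ r₁ r₂ ⟩
  (2 + v₁) * suc r₂ + suc v₂ * (2 + r₁)             ≡⟨ cong₂ _+_ e₁ (sym e₂) ⟩
  (2 + v₂) * suc r₁ + suc v₁ * (2 + r₂)             ≡⟨ sym (expand v₂ v₁ r₂ r₁) ⟩
  r₁ + v₁ + (v₂ * r₁ + (v₁ * r₂ + (r₂ + r₁ + v₂ + v₁ + 4))) ≡⟨ cong (λ z → r₁ + v₁ + z) (reorder v₁ v₂ r₁ r₂) ⟩
  r₁ + v₁ + K                                       ∎)
  where
  K : ℕ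
  K = v₁ * r₂ + (v₂ * r₁ + (r₁ + r₂ + v₁ + v₂ + 4))
  expand : ∀ v₁ v₂ r₁ r₂ → r₂ + v₂ + (v₁ * r₂ + (v₂ * r₁ + (r₁ + r₂ + v₁ + v₂ + 4))) ≡ (2 + v₁) * suc r₂ + suc v₂ * (2 + r₁)
  expand = ℕ.solve-∀
  reorder : ∀ v₁ v₂ r₁ r₂ → v₂ * r₁ + (v₁ * r₂ + (r₂ + r₁ + v₂ + v₁ + 4)) ≡ v₁ * r₂ + (v₂ * r₁ + (r₁ + r₂ + v₁ + v₂ + 4))
  reorder = ℕ.solve-∀

ratios-monotone : ∀ v₁ v₂ r₁ r₂ → (2 + v₁) * suc r₂ ≡ (2 + v₂) * suc r₁ → r₂ + v₂ ≡ r₁ + v₁ →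
                  r₁ < r₂ → ⊥
ratios-monotone v₁ v₂ r₁ r₂ e₁ sum r₁<r₂ = <-irrefl (sym e₁) (*-mono-< (s≤s (s≤s v₂<v₁)) (s≤s r₁<r₂))
  where
  v₂<v₁ : v₂ < v₁
  v₂<v₁ = +-cancelˡ-< r₁ v₂ v₁ (<-≤-trans (+-monoˡ-< v₂ r₁<r₂) (≤-reflexive sum))

-- The ratios (j - r) / (r + 1) and (j - r - 1) / (r + 2) of consecutive binomials, with j = r + 2 + v,
-- determine r.
consecutive-ratios-injective : ∀ v₁ v₂ r₁ r₂ → (2 + v₁) * suc r₂ ≡ (2 + v₂) * suc r₁ →
                               suc v₁ * (2 + r₂) ≡ suc v₂ * (2 + r₁) → r₁ ≡ r₂
consecutive-ratios-injective v₁ v₂ r₁ r₂ e₁ e₂ with <-cmp r₁ r₂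
... | tri≈ _ r₁≡r₂ _ = r₁≡r₂
... | tri< r₁<r₂ _ _ = contradiction r₁<r₂ (ratios-monotone v₁ v₂ r₁ r₂ e₁ (ratios-sum v₁ v₂ r₁ r₂ e₁ e₂))
... | tri> _ _ r₂<r₁ = contradiction r₂<r₁ (ratios-monotone v₂ v₁ r₂ r₁ (sym e₁) (sym (ratios-sum v₁ v₂ r₁ r₂ e₁ e₂)))

∸-offsets : ∀ r j → 2 + r ≤ j → j ∸ r ≡ 2 + (j ∸ (2 + r)) × j ∸ suc r ≡ suc (j ∸ (2 + r))
∸-offsets zero    (suc (suc j)) _           = refl , refl
∸-offsets zero    (suc zero)    (s≤s ())
∸-offsets (suc r) (suc j)       (s≤s 2+r≤j) = ∸-offsets r j 2+r≤j

weighted-binomial-pos : ∀ a {j r} → r ≤ j → 0 < suc a * binomial j r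
weighted-binomial-pos a r≤j = ≤-trans (binomial-pos r≤j) (m≤n*m _ (suc a))

two-point-equation : ∀ a b i₁ j₁ i₂ j₂ {r₁ r₂ k} t → i₁ + r₁ ≡ k → i₂ + r₂ ≡ k → t + r₁ ≤ j₁ →
  moment coeff (t + k) ((a , i₁ , j₁) ∷ (b , i₂ , j₂) ∷ []) ≡ + 0 →
  even (t + r₁) ≡ not (even (t + r₂)) × suc a * binomial j₁ (t + r₁) ≡ suc b * binomial j₂ (t + r₂)
two-point-equation a b i₁ j₁ i₂ j₂ {r₁} {r₂} {k} t h₁ h₂ t+r₁≤j₁ eq =
  two-terms-cancel (t + r₁) (t + r₂) _ _ (begin
    alternate (t + r₁) (+ (suc a * binomial j₁ (t + r₁))) +ℤ alternate (t + r₂) (+ (suc b * binomial j₂ (t + r₂)))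
      ≡⟨ cong₂ _+ℤ_ (weighted a i₁ j₁ h₁) (weighted b i₂ j₂ h₂) ⟩
    + suc a *ℤ coeff (t + k) i₁ j₁ +ℤ + suc b *ℤ coeff (t + k) i₂ j₂
      ≡⟨ cong (+ suc a *ℤ coeff (t + k) i₁ j₁ +ℤ_) (sym (ℤ.+-identityʳ _)) ⟩
    moment coeff (t + k) ((a , i₁ , j₁) ∷ (b , i₂ , j₂) ∷ [])
      ≡⟨ eq ⟩
    + 0 ∎)
    (weighted-binomial-pos a t+r₁≤j₁)
  where
  weighted : ∀ c i j {r} → i + r ≡ k → alternate (t + r) (+ (suc c * binomial j (t + r))) ≡ + suc c *ℤ coeff (t + k) i j
  weighted c i j {r} i+r≡k = begin
    alternate (t + r) (+ (suc c * binomial j (t + r)))   ≡⟨ cong (alternate (t + r)) (ℤ.pos-* (suc c) _) ⟩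
    alternate (t + r) (+ suc c *ℤ + binomial j (t + r))  ≡⟨ sym (alternate-* (t + r) (+ suc c) _) ⟩
    + suc c *ℤ alternate (t + r) (+ binomial j (t + r))  ≡⟨ cong (+ suc c *ℤ_) (sym (coeff-at i (t + r) j i+[t+r]≡t+k)) ⟩
    + suc c *ℤ coeff (t + k) i j                          ∎
    where
    i+[t+r]≡t+k : i + (t + r) ≡ t + k
    i+[t+r]≡t+k = trans (+-comm i (t + r)) (trans (+-assoc t r i) (cong (λ z → t + z) (trans (+-comm r i) i+r≡k)))

-- The three equations force equal offsets r₁ = r₂, yet the k-th one needs opposite signs.
two-points-unbalanced : ∀ a b i₁ j₁ i₂ j₂ k → i₁ ≤ k → 2 + k ≤ i₁ + j₁ → i₂ ≤ k → 2 + k ≤ i₂ + j₂ →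
  moment coeff k ((a , i₁ , j₁) ∷ (b , i₂ , j₂) ∷ []) ≡ + 0 →
  moment coeff (1 + k) ((a , i₁ , j₁) ∷ (b , i₂ , j₂) ∷ []) ≡ + 0 →
  moment coeff (2 + k) ((a , i₁ , j₁) ∷ (b , i₂ , j₂) ∷ []) ≡ + 0 → ⊥
two-points-unbalanced a b i₁ j₁ i₂ j₂ k i₁≤k k+2≤d₁ i₂≤k k+2≤d₂ eq₀ eq₁ eq₂ =
  not-¬ refl (trans (proj₁ p₀) (cong (not ∘ even) (sym r₁≡r₂)))
  where
  r₁ r₂ : ℕ
  r₁ = k ∸ i₁
  r₂ = k ∸ i₂
  h₁ : i₁ + r₁ ≡ k
  h₁ = m+[n∸m]≡n i₁≤k
  h₂ : i₂ + r₂ ≡ k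
  h₂ = m+[n∸m]≡n i₂≤k
  room : ∀ {i j r} → i + r ≡ k → 2 + k ≤ i + j → 2 + r ≤ j
  room {i} {j} {r} i+r≡k k+2≤i+j =
    +-cancelˡ-≤ i (2 + r) j
      (subst (_≤ i + j) (sym (trans (+-suc i (suc r)) (cong suc (trans (+-suc i r) (cong suc i+r≡k))))) k+2≤i+j)
  2+r₁≤j₁ : 2 + r₁ ≤ j₁
  2+r₁≤j₁ = room h₁ k+2≤d₁
  1+r₁≤j₁ : 1 + r₁ ≤ j₁
  1+r₁≤j₁ = ≤-trans (n≤1+n (suc r₁)) 2+r₁≤j₁
  r₁≤j₁ : r₁ ≤ j₁
  r₁≤j₁ = ≤-trans (n≤1+n r₁) 1+r₁≤j₁
  p₀ : even r₁ ≡ not (even r₂) × suc a * binomial j₁ r₁ ≡ suc b * binomial j₂ r₂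
  p₀ = two-point-equation a b i₁ j₁ i₂ j₂ 0 h₁ h₂ r₁≤j₁ eq₀
  p₁ : even (1 + r₁) ≡ not (even (1 + r₂)) × suc a * binomial j₁ (1 + r₁) ≡ suc b * binomial j₂ (1 + r₂)
  p₁ = two-point-equation a b i₁ j₁ i₂ j₂ 1 h₁ h₂ 1+r₁≤j₁ eq₁
  p₂ : even (2 + r₁) ≡ not (even (2 + r₂)) × suc a * binomial j₁ (2 + r₁) ≡ suc b * binomial j₂ (2 + r₂)
  p₂ = two-point-equation a b i₁ j₁ i₂ j₂ 2 h₁ h₂ 2+r₁≤j₁ eq₂
  cross₀ : (j₁ ∸ r₁) * suc r₂ ≡ (j₂ ∸ r₂) * suc r₁
  cross₀ = binomial-cross (suc a) (suc b) j₁ j₂ r₁ r₂ (weighted-binomial-pos a r₁≤j₁) (proj₂ p₀) (proj₂ p₁)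
  cross₁ : (j₁ ∸ suc r₁) * (2 + r₂) ≡ (j₂ ∸ suc r₂) * (2 + r₁)
  cross₁ = binomial-cross (suc a) (suc b) j₁ j₂ (suc r₁) (suc r₂)
             (weighted-binomial-pos a 1+r₁≤j₁) (proj₂ p₁) (proj₂ p₂)
  o₁ : j₁ ∸ r₁ ≡ 2 + (j₁ ∸ (2 + r₁)) × j₁ ∸ suc r₁ ≡ suc (j₁ ∸ (2 + r₁))
  o₁ = ∸-offsets r₁ j₁ 2+r₁≤j₁
  o₂ : j₂ ∸ r₂ ≡ 2 + (j₂ ∸ (2 + r₂)) × j₂ ∸ suc r₂ ≡ suc (j₂ ∸ (2 + r₂))
  o₂ = ∸-offsets r₂ j₂ (room h₂ k+2≤d₂)
  r₁≡r₂ : r₁ ≡ r₂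
  r₁≡r₂ = consecutive-ratios-injective (j₁ ∸ (2 + r₁)) (j₂ ∸ (2 + r₂)) r₁ r₂
    (trans (cong (_* suc r₂) (sym (proj₁ o₁))) (trans cross₀ (cong (_* suc r₁) (proj₁ o₂))))
    (trans (cong (_* (2 + r₂)) (sym (proj₂ o₁))) (trans cross₁ (cong (_* (2 + r₁)) (proj₂ o₂))))

length-filter-count : ∀ f xs → length (filterᵇ (holds f ∘ point) xs) ≡ count direct f (map point xs)
length-filter-count f []              = refl
length-filter-count f ((_ , p) ∷ xs) with holds f p
... | true  = cong suc (length-filter-count f xs)
... | false = length-filter-count f xs

moment-filter : ∀ g k (p : WeightedPoint → Bool) xs → All (λ x → ¬ T (p x) → valueAt g k x ≡ + 0) xs →
                moment g k xs ≡ moment g k (filterᵇ p xs)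
moment-filter g k p []                 []           = refl
moment-filter g k p ((a , i , j) ∷ xs) (z ∷ zs) with p (a , i , j)
... | true  = cong (+ suc a *ℤ g k i j +ℤ_) (moment-filter g k p xs zs)
... | false = begin
  + suc a *ℤ g k i j +ℤ moment g k xs ≡⟨ cong (λ v → + suc a *ℤ v +ℤ moment g k xs) (z (λ ())) ⟩
  + suc a *ℤ + 0 +ℤ moment g k xs      ≡⟨ cong (_+ℤ moment g k xs) (ℤ.*-zeroʳ (+ suc a)) ⟩
  + 0 +ℤ moment g k xs                 ≡⟨ ℤ.+-identityˡ _ ⟩
  moment g k xs                         ≡⟨ moment-filter g k p xs zs ⟩
  moment g k (filterᵇ p xs)            ∎

none-of-three : ∀ a b c → ¬ T ((a ∨ (b ∨ c)) ∧ not (a ∧ (b ∧ c))) → ¬ T (a ∧ (b ∧ c)) → ¬ T a × ¬ T b × ¬ T c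
none-of-three false false false _      _    = (λ ()) , (λ ()) , (λ ())
none-of-three true  true  true  _      ¬all = contradiction _ ¬all
none-of-three true  true  false ¬some _    = contradiction _ ¬some
none-of-three true  false true  ¬some _    = contradiction _ ¬some
none-of-three true  false false ¬some _    = contradiction _ ¬some
none-of-three false true  true  ¬some _    = contradiction _ ¬some
none-of-three false true  false ¬some _    = contradiction _ ¬some
none-of-three false false true  ¬some _    = contradiction _ ¬some

coeff-uncovered-near : ∀ k t x → t ≤ 2 →
  ¬ T (holds (coveringPartly3 k) (point x)) → ¬ T (holds (coveringAll3 k) (point x)) → valueAt coeff (t + k) x ≡ + 0
coeff-uncovered-near k t (_ , i , j) t≤2 ¬partly ¬all =
  coeff-uncovered (t + k) i j (pick t t≤2 (none-of-three (covers k (i , j)) _ _ ¬partly ¬all))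
  where
  pick : ∀ t → t ≤ 2 → ¬ T (covers k (i , j)) × ¬ T (covers (1 + k) (i , j)) × ¬ T (covers (2 + k) (i , j)) →
         ¬ T (covers (t + k) (i , j))
  pick 0 _ (¬c , _)     = ¬c
  pick 1 _ (_ , ¬c , _) = ¬c
  pick 2 _ (_ , _ , ¬c) = ¬c
  pick (suc (suc (suc _))) (s≤s (s≤s ())) _

coveringAll3⇒ : ∀ k x → T (holds (coveringAll3 k) (point x)) → column x ≤ k × 2 + k ≤ degree x
coveringAll3⇒ k (_ , i , j) h with T-∧⁻ (covers k (i , j)) h
... | c₀ , c₁₂ =
  proj₁ (covers⇒ k i j c₀) , proj₂ (covers⇒ (2 + k) i j (proj₂ (T-∧⁻ (covers (suc k) (i , j)) c₁₂)))

pairTest-sound : ∀ xs k → Balanced coeff xs → 1 ≤ k → T (passes (pairTest k) (counts direct (map point xs))) → ⊥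
pairTest-sound xs k balanced 1≤k t with T-∧⁻ (count direct (coveringAll3 k) (map point xs) ≡ᵇ 2) t
... | #all≡2 , #partly≡0 =
  two-selected selected (trans (length-filter-count (coveringAll3 k) xs) (≡ᵇ⇒≡ _ 2 #all≡2))
    (All.all-filter (T? ∘ holds (coveringAll3 k) ∘ point) xs) balanced-near
  where
  selected : List WeightedPoint
  selected = filterᵇ (holds (coveringAll3 k) ∘ point) xs
  balanced-near : ∀ t → t ≤ 2 → moment coeff (t + k) selected ≡ + 0
  balanced-near t t≤2 = trans
    (sym (moment-filter coeff (t + k) _ xs
      (All.map (λ {x} → coeff-uncovered-near k t x t≤2) (count-zero (coveringPartly3 k) xs (≡ᵇ⇒≡ _ 0 #partly≡0)))))
    (balanced (t + k) (≤-trans 1≤k (m≤n+m k t)))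
  two-selected : ∀ ys → length ys ≡ 2 → All (T ∘ holds (coveringAll3 k) ∘ point) ys →
                 (∀ t → t ≤ 2 → moment coeff (t + k) ys ≡ + 0) → ⊥
  two-selected ((a , i₁ , j₁) ∷ (b , i₂ , j₂) ∷ []) _ (h₁ ∷ h₂ ∷ []) eqs =
    two-points-unbalanced a b i₁ j₁ i₂ j₂ k (proj₁ b₁) (proj₂ b₁) (proj₁ b₂) (proj₂ b₂)
      (eqs 0 z≤n) (eqs 1 (s≤s z≤n)) (eqs 2 (s≤s (s≤s z≤n)))
    where
    b₁ : i₁ ≤ k × 2 + k ≤ i₁ + j₁
    b₁ = coveringAll3⇒ k (a , i₁ , j₁) h₁
    b₂ : i₂ ≤ k × 2 + k ≤ i₂ + j₂
    b₂ = coveringAll3⇒ k (b , i₂ , j₂) h₂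

reach : Feature → ℕ
reach (positiveAt k)      = k
reach (negativeAt k)      = k
reach (covering k)        = k
reach (beyond k)          = k
reach (coveringAll3 k)    = 2 + k
reach (coveringPartly3 k) = 2 + k
reach highDegree          = 6

testReach : Test → ℕ
testReach (signTest k) = k
testReach (gapTest k)  = k
testReach (pairTest k) = 2 + k

passes-cong : ∀ t {c c′} → (∀ f → reach f ≤ testReach t → c f ≡ c′ f) → passes t c ≡ passes t c′
passes-cong (signTest k) eq rewrite eq (positiveAt k) ≤-refl | eq (negativeAt k) ≤-refl = refl
passes-cong (gapTest k)  eq rewrite eq (covering k) ≤-refl | eq (beyond k) ≤-refl = refl
passes-cong (pairTest k) eq rewrite eq (coveringAll3 k) ≤-refl | eq (coveringPartly3 k) ≤-refl = refl

transposeᵂ : WeightedPoint → WeightedPoint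
transposeᵂ (a , i , j) = a , j , i

moment-transpose : ∀ k xs → moment coeffᵀ k xs ≡ moment coeff k (map transposeᵂ xs)
moment-transpose k []                 = refl
moment-transpose k ((a , i , j) ∷ xs) = cong (+ suc a *ℤ coeff k j i +ℤ_) (moment-transpose k xs)

balanced-transpose : ∀ xs → Balanced coeffᵀ xs → Balanced coeff (map transposeᵂ xs)
balanced-transpose xs balancedᵀ k 1≤k = trans (sym (moment-transpose k xs)) (balancedᵀ k 1≤k)

count-transpose : ∀ f xs → count transposed f (map point xs) ≡ count direct f (map point (map transposeᵂ xs))
count-transpose f []                 = refl
count-transpose f ((a , i , j) ∷ xs) with holds f (j , i)
... | true  = cong suc (count-transpose f xs)
... | false = count-transpose f xs

direct-test-sound : ∀ xs → Balanced coeff xs → ∀ t → 1 ≤ level t → ¬ T (passes t (counts direct (map point xs)))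
direct-test-sound xs balanced (signTest k) = signTest-sound xs k balanced
direct-test-sound xs balanced (gapTest k) _ = gapTest-sound xs k balanced
direct-test-sound xs balanced (pairTest k) = pairTest-sound xs k balanced

test-sound : ∀ xs → Balanced coeff xs → Balanced coeffᵀ xs → ∀ s t → 1 ≤ level t → ¬ T (runTest (map point xs) (s , t))
test-sound xs balanced _ direct t = direct-test-sound xs balanced t
test-sound xs _ balancedᵀ transposed t 1≤level =
  direct-test-sound (map transposeᵂ xs) (balanced-transpose xs balancedᵀ) t 1≤level
  ∘ subst T (passes-cong t (λ f _ → count-transpose f xs))

tests-level : All (λ st → 1 ≤ level (proj₂ st)) tests
tests-level = All.map (λ {st} → ≤ᵇ⇒≤ 1 (level (proj₂ st))) (All.all⁺ (λ st → 1 ≤ᵇ level (proj₂ st)) tests _)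

check-sound : ∀ xs → Balanced coeff xs → Balanced coeffᵀ xs → T (check (map point xs)) → All (λ x → degree x ≤ 5) xs
check-sound xs balanced balancedᵀ c with T-∨⁻ (count direct highDegree (map point xs) ≡ᵇ 0) c
... | inj₁ #high≡0 = All.map (λ {x} → low x) (count-zero highDegree xs (≡ᵇ⇒≡ _ 0 #high≡0))
  where
  low : ∀ x → ¬ T (holds highDegree (point x)) → degree x ≤ 5
  low (_ , i , j) ¬high = ≤-pred (≰ᵇ⇒> ¬high)
... | inj₂ some with find (Any.any⁻ (runTest (map point xs)) tests some)
... | (s , t) , st∈ , p = ⊥-elim (test-sound xs balanced balancedᵀ s t (All.lookup tests-level st∈) p)

-- Reordering and capping

count-↭ : ∀ s f {ps qs} → ps ↭ qs → count s f ps ≡ count s f qs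
count-↭ s f ↭.refl                = refl
count-↭ s f (↭.prep p ps↭qs)      = cong (λ n → if holds f (orient s p) then suc n else n) (count-↭ s f ps↭qs)
count-↭ s f (↭.swap p q ps↭qs)    with holds f (orient s p) | holds f (orient s q)
... | true  | true  = cong (suc ∘ suc) (count-↭ s f ps↭qs)
... | true  | false = cong suc (count-↭ s f ps↭qs)
... | false | true  = cong suc (count-↭ s f ps↭qs)
... | false | false = count-↭ s f ps↭qs
count-↭ s f (↭.trans ps↭qs qs↭rs) = trans (count-↭ s f ps↭qs) (count-↭ s f qs↭rs)

check-↭ : ∀ {ps qs} → ps ↭ qs → check ps ≡ check qs
check-↭ ps↭qs = cong₂ _∨_ (cong (_≡ᵇ 0) (count-↭ direct highDegree ps↭qs))
  (cong or (map-cong (λ st → passes-cong (proj₂ st) (λ f _ → count-↭ (proj₁ st) f ps↭qs)) tests))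

-- Coordinates beyond 7 are indistinguishable for features inspecting diagonals up to 6.
cap : ℕ → ℕ
cap n = n ⊓ 7

capPoint : ℕ × ℕ → ℕ × ℕ
capPoint (i , j) = cap i , cap j

cap-≤ : ∀ n → cap n ≤ n
cap-≤ n = m⊓n≤m n 7

≤-cap : ∀ {k n} → k ≤ 7 → k ≤ n → k ≤ cap n
≤-cap k≤7 k≤n = ⊓-glb k≤n k≤7

cap-≤-small : ∀ {k} n → k < 7 → cap n ≤ k → n ≤ k
cap-≤-small n k<7 cap≤k with ≤-total n 7
... | inj₁ n≤7 = subst (_≤ _) (m≤n⇒m⊓n≡m n≤7) cap≤k
... | inj₂ 7≤n = contradiction (subst (_≤ _) (m≥n⇒m⊓n≡n 7≤n) cap≤k) (<⇒≱ k<7)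

≤-cap+cap : ∀ {k} i j → k ≤ 7 → k ≤ i + j → k ≤ cap i + cap j
≤-cap+cap {k} i j k≤7 k≤i+j with ≤-total i 7 | ≤-total j 7
... | inj₂ 7≤i | _      = ≤-trans k≤7 (≤-trans (≤-reflexive (sym (m≥n⇒m⊓n≡n 7≤i))) (m≤m+n _ _))
... | inj₁ _   | inj₂ 7≤j = ≤-trans k≤7 (≤-trans (≤-reflexive (sym (m≥n⇒m⊓n≡n 7≤j))) (m≤n+m _ _))
... | inj₁ i≤7 | inj₁ j≤7 = subst (k ≤_) (sym (cong₂ _+_ (m≤n⇒m⊓n≡m i≤7) (m≤n⇒m⊓n≡m j≤7))) k≤i+j

≤ᵇ-cong : ∀ {m n m′ n′} → (m ≤ n → m′ ≤ n′) → (m′ ≤ n′ → m ≤ n) → (m ≤ᵇ n) ≡ (m′ ≤ᵇ n′)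
≤ᵇ-cong {m} {n} {m′} {n′} to from with m ≤ᵇ n in e | m′ ≤ᵇ n′ in e′
... | true  | true  = refl
... | false | false = refl
... | true  | false = contradiction (to (≤ᵇ⇒≤ m n (subst T (sym e) _))) (λ le → subst T e′ (≤⇒≤ᵇ le))
... | false | true  = contradiction (from (≤ᵇ⇒≤ m′ n′ (subst T (sym e′) _))) (λ le → subst T e (≤⇒≤ᵇ le))

covers-cap : ∀ k i j → k ≤ 6 → covers k (capPoint (i , j)) ≡ covers k (i , j)
covers-cap k i j k≤6 = cong₂ _∧_
  (≤ᵇ-cong (cap-≤-small i (s≤s k≤6)) (≤-trans (cap-≤ i)))
  (≤ᵇ-cong (λ le → ≤-trans le (+-mono-≤ (cap-≤ i) (cap-≤ j))) (≤-cap+cap i j (≤-trans k≤6 (n≤1+n 6))))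

-- Where the point covers k ≤ 6, its column is not capped.
covered-column-cap : ∀ k i j (φ : ℕ → Bool) → k ≤ 6 →
                     covers k (i , j) ∧ φ (k ∸ cap i) ≡ covers k (i , j) ∧ φ (k ∸ i)
covered-column-cap k i j φ k≤6 with covers k (i , j) in e
... | false = refl
... | true  =
  cong (λ n → φ (k ∸ n)) (m≤n⇒m⊓n≡m (≤-trans (proj₁ (covers⇒ k i j (subst T (sym e) _))) (≤-trans k≤6 (n≤1+n 6))))

holds-cap : ∀ f → reach f ≤ 6 → ∀ p → holds f (capPoint p) ≡ holds f p
holds-cap (positiveAt k) k≤6 (i , j) =
  trans (cong (_∧ even (k ∸ cap i)) (covers-cap k i j k≤6)) (covered-column-cap k i j even k≤6)
holds-cap (negativeAt k) k≤6 (i , j) =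
  trans (cong (_∧ not (even (k ∸ cap i))) (covers-cap k i j k≤6)) (covered-column-cap k i j (not ∘ even) k≤6)
holds-cap (covering k) k≤6 (i , j) = covers-cap k i j k≤6
holds-cap (beyond k) k≤6 (i , j) = ≤ᵇ-cong (λ le → ≤-trans le (cap-≤ i)) (≤-cap (s≤s k≤6))
holds-cap (coveringAll3 k) 2+k≤6 (i , j)
  rewrite covers-cap k i j (≤-trans (m≤n+m k 2) 2+k≤6) | covers-cap (suc k) i j (≤-trans (n≤1+n (suc k)) 2+k≤6)
        | covers-cap (2 + k) i j 2+k≤6 = refl
holds-cap (coveringPartly3 k) 2+k≤6 (i , j)
  rewrite covers-cap k i j (≤-trans (m≤n+m k 2) 2+k≤6) | covers-cap (suc k) i j (≤-trans (n≤1+n (suc k)) 2+k≤6)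
        | covers-cap (2 + k) i j 2+k≤6 = refl
holds-cap highDegree _ (i , j) = ≤ᵇ-cong (λ le → ≤-trans le (+-mono-≤ (cap-≤ i) (cap-≤ j))) (≤-cap+cap i j (n≤1+n 6))

orient-cap : ∀ s p → orient s (capPoint p) ≡ capPoint (orient s p)
orient-cap direct     p = refl
orient-cap transposed p = refl

count-cap : ∀ s f → reach f ≤ 6 → ∀ ps → count s f (map capPoint ps) ≡ count s f ps
count-cap s f r []             = refl
count-cap s f r (p ∷ ps) rewrite orient-cap s p | holds-cap f r (orient s p) | count-cap s f r ps = refl

tests-reach : All (λ st → testReach (proj₂ st) ≤ 6) tests
tests-reach = All.map (λ {st} → ≤ᵇ⇒≤ (testReach (proj₂ st)) 6) (All.all⁺ (λ st → testReach (proj₂ st) ≤ᵇ 6) tests _)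

check-cap : ∀ ps → check (map capPoint ps) ≡ check ps
check-cap ps = cong₂ _∨_ (cong (_≡ᵇ 0) (count-cap direct highDegree ≤-refl ps))
  (cong or (map-cong-local (All.map
    (λ {st} r → passes-cong (proj₂ st) (λ f rf≤rt → count-cap (proj₁ st) f (≤-trans rf≤rt r) ps)) tests-reach)))

all-lookup : ∀ {A : Set} (p : A → Bool) {xs} x → x ∈ xs → all p xs ≡ true → p x ≡ true
all-lookup p {xs} x x∈ e = Equivalence.to T-≡ (All.lookup (All.all⁺ p xs (Equivalence.from T-≡ e)) x∈)

capped : List ℕ
capped = upTo 8

cappedPositive : List ℕ
cappedPositive = applyUpTo suc 7

grid : List (ℕ × ℕ)
grid = cartesianProduct capped capped

cap∈capped : ∀ n → cap n ∈ capped
cap∈capped n = ∈-upTo⁺ (s≤s (m⊓n≤n n 7))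

cap∈cappedPositive : ∀ {n} → 1 ≤ n → cap n ∈ cappedPositive
cap∈cappedPositive {n} 1≤n with cap n | ≤-cap {1} {n} (s≤s z≤n) 1≤n | m⊓n≤n n 7
... | suc m | _ | m<7 = ∈-applyUpTo⁺ suc m<7

capPoint∈grid : ∀ p → capPoint p ∈ grid
capPoint∈grid (i , j) = ∈-cartesianProduct⁺ (cap∈capped i) (cap∈capped j)

shapeA : ℕ × (ℕ × ℕ) × (ℕ × ℕ) → List (ℕ × ℕ)
shapeA (j , p , q) = (0 , j) ∷ (1 , 0) ∷ p ∷ q ∷ []

shapeB : ℕ × ℕ × ℕ × (ℕ × ℕ) → List (ℕ × ℕ)
shapeB (j₁ , j₂ , i , q) = (0 , j₁) ∷ (1 , j₂) ∷ (i , 0) ∷ q ∷ []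

shapeA-enumerated : all (λ t → check (shapeA t)) (cartesianProduct cappedPositive (cartesianProduct grid grid)) ≡ true
shapeA-enumerated = refl

shapeB-enumerated : all (λ t → check (shapeB t))
                   (cartesianProduct cappedPositive (cartesianProduct cappedPositive (cartesianProduct cappedPositive grid))) ≡ true
shapeB-enumerated = refl

shapeA-passes : ∀ (t : ℕ × (ℕ × ℕ) × (ℕ × ℕ)) → t ∈ cartesianProduct cappedPositive (cartesianProduct grid grid) →
                check (shapeA t) ≡ true
shapeA-passes t t∈ = all-lookup (λ t → check (shapeA t)) t t∈ shapeA-enumerated

shapeB-passes : ∀ (t : ℕ × ℕ × ℕ × (ℕ × ℕ)) →
                t ∈ cartesianProduct cappedPositive (cartesianProduct cappedPositive (cartesianProduct cappedPositive grid)) →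
               check (shapeB t) ≡ true
shapeB-passes t t∈ = all-lookup (λ t → check (shapeB t)) t t∈ shapeB-enumerated

AtOrigin OnColumnAxis OnRowAxis : WeightedPoint → Set
AtOrigin     x = column x ≡ 0 × row x ≡ 0
OnColumnAxis x = column x ≡ 0 × 0 < row x
OnRowAxis    x = row x ≡ 0 × 0 < column x

onColumnAxis? : Decidable OnColumnAxis
onColumnAxis? x = (column x ≟ 0) ×-dec (0 <? row x)

at-origin : ∀ x → ¬ OnColumnAxis x → column x ≤ 0 → AtOrigin x
at-origin (_ , zero , zero)  _    _ = refl , refl
at-origin (_ , zero , suc j) ¬axis _ = contradiction (refl , s≤s z≤n) ¬axis

origin-degree : ∀ {n} x → AtOrigin x → degree x ≤ n
origin-degree (_ , zero , zero) _ = z≤n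

origin-or-column-axis : ∀ xs → Balanced coeff xs → All AtOrigin xs ⊎ Any OnColumnAxis xs
origin-or-column-axis xs balanced with any? onColumnAxis? xs
... | yes axis = inj₂ axis
... | no ¬axis = inj₁ (All.zipWith (λ {x} → uncurry (at-origin x)) (off-axis , columns-bounded 0 xs balanced low))
  where
  off-axis : All (¬_ ∘ OnColumnAxis) xs
  off-axis = All.¬Any⇒All¬ xs ¬axis
  low : All (λ x → column x ≤ 0 → degree x ≤ 0) xs
  low = All.map (λ {x} ¬axis c≤0 → origin-degree x (at-origin x ¬axis c≤0)) off-axis

-- With column 1 empty, moment 1 of the negated coefficients is ∑ (1 + a) j over column 0,
-- which a point (0 , j ≥ 1) makes positive.
column-one : ∀ xs → Balanced coeff xs → Any OnColumnAxis xs → Any (λ x → column x ≡ 1) xs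
column-one xs balanced axis with any? (λ x → column x ≟ 1) xs
... | yes in-column-one = in-column-one
... | no ¬in-column-one = ⊥-elim (moment≢0 (negated coeff) 1 xs
      (All.map (λ {x} → nonNegative x) (All.¬Any⇒All¬ xs ¬in-column-one)) (Any.map (λ {x} → positive x) axis)
      (trans (moment-negated coeff 1 xs) (cong -_ (balanced 1 (s≤s z≤n)))))
  where
  nonNegative : ∀ x → column x ≢ 1 → NonNegativeAt (negated coeff) 1 x
  nonNegative (_ , 0 , j)             _   = binomial j 1 , ℤ.neg-involutive _
  nonNegative (_ , 1 , j)             c≢1 = contradiction refl c≢1
  nonNegative (_ , suc (suc i) , j)   _   = 0 , refl
  positive : ∀ x → OnColumnAxis x → PositiveAt (negated coeff) 1 x
  positive (_ , 0 , suc j) _ = binomial j 1 , ℤ.neg-involutive _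

row-axis : ∀ xs → Balanced coeffᵀ xs → Any OnColumnAxis xs → Any OnRowAxis xs
row-axis xs balancedᵀ axis with origin-or-column-axis (map transposeᵂ xs) (balanced-transpose xs balancedᵀ)
... | inj₂ axisᵀ = Any.map (λ {x} → flip x) (Any.map⁻ axisᵀ)
  where
  flip : ∀ x → OnColumnAxis (transposeᵂ x) → OnRowAxis x
  flip (_ , i , j) (j≡0 , 0<i) = j≡0 , 0<i
... | inj₁ originᵀ with find axis
...   | (_ , _ , j) , x∈ , _ , 0<j with All.lookup (All.map⁻ originᵀ) x∈
...     | j≡0 , _ = contradiction j≡0 (>⇒≢ 0<j)

extract : ∀ {A : Set} {x : A} {xs} → x ∈ xs → ∃ λ rest → xs ↭ x ∷ rest
extract {x = x} x∈ with ∈-∃++ x∈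
... | ys , zs , refl = ys ++ zs , shift x ys zs

∈-extracted : ∀ {A : Set} {x y : A} {xs rest} → y ∈ xs → xs ↭ x ∷ rest → y ≢ x → y ∈ rest
∈-extracted y∈ xs↭x∷rest y≢x with ∈-resp-↭ xs↭x∷rest y∈
... | here y≡x = contradiction y≡x y≢x
... | there y∈rest = y∈rest

extract-two : ∀ {A : Set} {x y : A} {xs} → x ∈ xs → y ∈ xs → y ≢ x → ∃ λ rest → xs ↭ x ∷ y ∷ rest
extract-two x∈ y∈ y≢x with extract x∈
... | rest , xs↭x∷rest with extract (∈-extracted y∈ xs↭x∷rest y≢x)
... | rest′ , rest↭y∷rest′ = rest′ , ↭-trans xs↭x∷rest (prep _ rest↭y∷rest′)

extract-three : ∀ {A : Set} {x y z : A} {xs} → x ∈ xs → y ∈ xs → z ∈ xs → y ≢ x → z ≢ x → z ≢ y →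
                ∃ λ rest → xs ↭ x ∷ y ∷ z ∷ rest
extract-three x∈ y∈ z∈ y≢x z≢x z≢y with extract-two x∈ y∈ y≢x
... | rest , xs↭x∷y∷rest with extract (∈-extracted (∈-extracted z∈ xs↭x∷y∷rest z≢x) ↭-refl z≢y)
... | rest′ , rest↭z∷rest′ = rest′ , ↭-trans xs↭x∷y∷rest (prep _ (prep _ rest↭z∷rest′))

length≡2 : ∀ {A : Set} (xs : List A) → length xs ≡ 2 → ∃₂ λ p q → xs ≡ p ∷ q ∷ []
length≡2 (p ∷ q ∷ []) _ = p , q , refl

length≡1 : ∀ {A : Set} (xs : List A) → length xs ≡ 1 → ∃ λ q → xs ≡ q ∷ []
length≡1 (q ∷ []) _ = q , refl

checked-via : ∀ xs ys L → xs ↭ ys → map capPoint (map point ys) ≡ L → check L ≡ true → T (check (map point xs))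
checked-via xs ys _ xs↭ys refl ok = Equivalence.from T-≡
  (trans (check-↭ (map⁺ point xs↭ys)) (trans (sym (check-cap (map point ys))) ok))

shapeA-case : ∀ xs a j b → length xs ≡ 4 → (a , 0 , j) ∈ xs → (b , 1 , 0) ∈ xs → 0 < j → T (check (map point xs))
shapeA-case xs a j b #xs≡4 x∈ y∈ 0<j with extract-two x∈ y∈ (λ ())
... | rest , perm with length≡2 rest (suc-injective (suc-injective (trans (sym (↭-length perm)) #xs≡4)))
... | p , q , refl =
  checked-via xs ((a , 0 , j) ∷ (b , 1 , 0) ∷ p ∷ q ∷ []) (shapeA (cap j , capPoint (point p) , capPoint (point q))) perm refl
    (shapeA-passes (cap j , capPoint (point p) , capPoint (point q))
      (∈-cartesianProduct⁺ (cap∈cappedPositive 0<j)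
        (∈-cartesianProduct⁺ (capPoint∈grid (point p)) (capPoint∈grid (point q)))))

shapeB-case : ∀ xs a j b j′ c i → length xs ≡ 4 → (a , 0 , j) ∈ xs → (b , 1 , j′) ∈ xs → (c , i , 0) ∈ xs →
              0 < j → 0 < j′ → 0 < i → T (check (map point xs))
shapeB-case xs a j b j′ c i #xs≡4 x∈ y∈ z∈ 0<j 0<j′ 0<i with extract-three x∈ y∈ z∈ (λ ()) z≢x z≢y
  where
  z≢x : (c , i , 0) ≢ (a , 0 , j)
  z≢x refl = contradiction refl (>⇒≢ 0<j)
  z≢y : (c , i , 0) ≢ (b , 1 , j′)
  z≢y refl = contradiction refl (>⇒≢ 0<j′)
... | rest , perm with length≡1 rest (suc-injective (suc-injective (suc-injective (trans (sym (↭-length perm)) #xs≡4))))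
... | q , refl =
  checked-via xs ((a , 0 , j) ∷ (b , 1 , j′) ∷ (c , i , 0) ∷ q ∷ [])
    (shapeB (cap j , cap j′ , cap i , capPoint (point q))) perm refl
    (shapeB-passes (cap j , cap j′ , cap i , capPoint (point q))
      (∈-cartesianProduct⁺ (cap∈cappedPositive 0<j) (∈-cartesianProduct⁺ (cap∈cappedPositive 0<j′)
        (∈-cartesianProduct⁺ (cap∈cappedPositive 0<i) (capPoint∈grid (point q))))))

-- A point (0 , j ≥ 1), a point in column 1 and, unless that one is (1 , 0), a point (i ≥ 1 , 0):
-- up to order and capping, one of the enumerated shapes.
four-points-checked : ∀ xs → length xs ≡ 4 → Any OnColumnAxis xs → Any (λ x → column x ≡ 1) xs → Any OnRowAxis xs →
                      T (check (map point xs))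
four-points-checked xs #xs≡4 axis col₁ rowAxis with find axis | find col₁ | find rowAxis
... | (a , _ , j) , x∈ , refl , 0<j | (b , _ , zero)  , y∈ , refl | _ =
  shapeA-case xs a j b #xs≡4 x∈ y∈ 0<j
... | (a , _ , j) , x∈ , refl , 0<j | (b , _ , suc j′) , y∈ , refl | (c , i , _) , z∈ , refl , 0<i =
  shapeB-case xs a j b (suc j′) c i #xs≡4 x∈ y∈ z∈ 0<j (s≤s z≤n) 0<i

degree-bound : ∀ xs → length xs ≡ 4 → Balanced coeff xs → Balanced coeffᵀ xs → All (λ x → degree x ≤ 5) xs
degree-bound xs #xs≡4 balanced balancedᵀ with origin-or-column-axis xs balanced
... | inj₁ origin = All.map (λ {x} → origin-degree x) origin
... | inj₂ axis   = check-sound xs balanced balancedᵀ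
  (four-points-checked xs #xs≡4 axis (column-one xs balanced axis) (row-axis xs balancedᵀ axis))

-- Outcomes

Supported : ℕ → Config → Set
Supported d w = ∀ x y → d < x + y → w x y ≡ + 0

chip-supported : ∀ {d a b} → a + b ≤ d → Supported d (chip a b)
chip-supported {a = a} {b} a+b≤d x y d<x+y = chip-elsewhere {a} {b} {x} {y} λ where (refl , refl) → <⇒≱ d<x+y a+b≤d

⊕-supported : ∀ {d u v} → Supported d u → Supported d v → Supported d (u ⊕ v)
⊕-supported su sv x y lt rewrite su x y lt | sv x y lt = refl

⊖-supported : ∀ {d u v} → Supported d u → Supported d v → Supported d (u ⊖ v)
⊖-supported su sv x y lt rewrite su x y lt | sv x y lt = refl

outcome-supported : ∀ {d w} → Outcome d w → Supported d w
outcome-supported {d} (ms , ms∈ , run≡w) x y lt = trans (sym (run≡w x y)) (run-supported ms ms∈ x y lt)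
  where
  run-supported : ∀ ms → All (MoveIn d) ms → Supported d (run ms)
  run-supported []                []           = λ _ _ _ → refl
  run-supported (split i j ∷ ms)   (i+j<d ∷ ms∈) =
    ⊕-supported (⊕-supported (⊖-supported (run-supported ms ms∈) (chip-supported (<⇒≤ i+j<d)))
      (chip-supported i+j<d)) (chip-supported (≤-trans (≤-reflexive (+-suc i j)) i+j<d))
  run-supported (unsplit i j ∷ ms) (i+j<d ∷ ms∈) =
    ⊖-supported (⊖-supported (⊕-supported (run-supported ms ms∈) (chip-supported (<⇒≤ i+j<d)))
      (chip-supported i+j<d)) (chip-supported (≤-trans (≤-reflexive (+-suc i j)) i+j<d))

∈-V : ∀ {d x y} → x + y ≤ d → (x , y) ∈ V d
∈-V {d} {x} {y} x+y≤d = ∈-concatMap⁺ diagonal (lose (∈-upTo⁺ (s≤s x+y≤d))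
  (subst (λ z → (x , z) ∈ diagonal (x + y)) (m+n∸m≡n x y) (∈-map⁺ (cell (x + y)) (∈-upTo⁺ (s≤s (m≤m+n x y))))))

outcome-inside : ∀ {d w x y} → Outcome d w → w x y ≢ + 0 → x + y ≤ d
outcome-inside {d} {w} {x} {y} outcome w≢0 with ≤-<-connex (x + y) d
... | inj₁ x+y≤d = x+y≤d
... | inj₂ d<x+y = contradiction (outcome-supported outcome x y d<x+y) w≢0

valid-off-origin : ∀ {w x y} → Valid w → (x , y) ≢ (0 , 0) → ¬ (+ 0 ℤ.< w x y) → w x y ≡ + 0
valid-off-origin {x = x} {y} valid off ¬0<w = ℤ.≤-antisym (ℤ.≮⇒≥ ¬0<w) (valid x y off)

valid-nonzero-nonpositive : ∀ {w x y n} → Valid w → w x y ≢ + 0 → ¬ (+ 0 ℤ.< w x y) → x + y ≤ n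
valid-nonzero-nonpositive {x = zero}  {zero}  _     _   _    = z≤n
valid-nonzero-nonpositive {x = zero}  {suc _} valid w≢0 ¬0<w = contradiction (valid-off-origin valid (λ ()) ¬0<w) w≢0
valid-nonzero-nonpositive {x = suc _} {_}     valid w≢0 ¬0<w = contradiction (valid-off-origin valid (λ ()) ¬0<w) w≢0

positive-view : ∀ {z} → + 0 ℤ.< z → ∃ λ a → z ≡ + suc a
positive-view {+[1+ a ]} _            = a , refl
positive-view {+ 0}      (ℤ.+<+ ())

PositiveIn : Config → ℕ × ℕ → Set
PositiveIn w p = + 0 ℤ.< w (proj₁ p) (proj₂ p)

weighted : ∀ w ps → All (PositiveIn w) ps → List WeightedPoint
weighted w []             []           = []
weighted w ((i , j) ∷ ps) (0<w ∷ 0<ws) = (proj₁ (positive-view 0<w) , i , j) ∷ weighted w ps 0<ws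

map-point-weighted : ∀ w ps 0<ws → map point (weighted w ps 0<ws) ≡ ps
map-point-weighted w []             []           = refl
map-point-weighted w ((i , j) ∷ ps) (0<w ∷ 0<ws) = cong ((i , j) ∷_) (map-point-weighted w ps 0<ws)

moment-weighted : ∀ w g k ps 0<ws →
  moment g k (weighted w ps 0<ws) ≡ ∑ ps (λ p → w (proj₁ p) (proj₂ p) *ℤ g k (proj₁ p) (proj₂ p))
moment-weighted w g k []             []           = refl
moment-weighted w g k ((i , j) ∷ ps) (0<w ∷ 0<ws) =
  cong₂ _+ℤ_ (cong (_*ℤ g k i j) (sym (proj₂ (positive-view 0<w)))) (moment-weighted w g k ps 0<ws)

suppPos-positive : ∀ d w → All (PositiveIn w) (suppPos d w)
suppPos-positive d w = All.all-filter (λ p → + 0 ℤ.<? w (proj₁ p) (proj₂ p)) (V d)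

support : ℕ → Config → List WeightedPoint
support d w = weighted w (suppPos d w) (suppPos-positive d w)

support-balanced : ∀ {d w} g → (∀ k → IsPascal (g k)) → (∀ k → 1 ≤ k → g k 0 0 ≡ + 0) →
                   Outcome d w → Valid w → Balanced g (support d w)
support-balanced {d} {w} g pascal origin outcome valid k 1≤k = begin
  moment g k (support d w)   ≡⟨ moment-weighted w g k (suppPos d w) (suppPos-positive d w) ⟩
  ∑ (suppPos d w) F          ≡⟨ ∑-filter (λ p → + 0 ℤ.<? w (proj₁ p) (proj₂ p)) (V d) vanish ⟩
  pairing d (g k) w          ≡⟨ pairing-outcome (g k) (pascal k) w outcome ⟩
  + 0                        ∎
  where
  F : ℕ × ℕ → ℤ
  F p = w (proj₁ p) (proj₂ p) *ℤ g k (proj₁ p) (proj₂ p)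
  vanish : ∀ p → ¬ PositiveIn w p → F p ≡ + 0
  vanish (zero , zero)  _    = trans (cong (w 0 0 *ℤ_) (origin k 1≤k)) (ℤ.*-zeroʳ (w 0 0))
  vanish (zero , suc j) ¬0<w = cong (_*ℤ g k 0 (suc j)) (valid-off-origin valid (λ ()) ¬0<w)
  vanish (suc i , j)    ¬0<w = cong (_*ℤ g k (suc i) j) (valid-off-origin valid (λ ()) ¬0<w)

coeff-origin : ∀ k → 1 ≤ k → coeff k 0 0 ≡ + 0
coeff-origin (suc k) _ = alternate-0 (suc k)

coeffᵀ-pascal : ∀ k → IsPascal (coeffᵀ k)
coeffᵀ-pascal k i j = trans (coeff-pascal k j i) (ℤ.+-comm (coeff k (suc j) i) (coeff k j (suc i)))

support-degree-bound : ∀ {d w} → Outcome d w → Valid w → length (suppPos d w) ≡ 4 →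
                       All (λ p → proj₁ p + proj₂ p ≤ 5) (suppPos d w)
support-degree-bound {d} {w} outcome valid #supp≡4 =
  subst (All _) point-support (All.map⁺ (degree-bound (support d w)
    (trans (sym (length-map point (support d w))) (trans (cong length point-support) #supp≡4))
    (support-balanced coeff coeff-pascal coeff-origin outcome valid)
    (support-balanced coeffᵀ coeffᵀ-pascal coeff-origin outcome valid)))
  where
  point-support : map point (support d w) ≡ suppPos d w
  point-support = map-point-weighted w (suppPos d w) (suppPos-positive d w)

theorem6p20 : (d : ℕ) (w : Config) → Outcome d w → Valid w →
    length (suppPos d w) ≡ 4 → DegLe w 5
theorem6p20 d w outcome valid #supp≡4 x y w≢0 with + 0 ℤ.<? w x y
... | no ¬0<w = valid-nonzero-nonpositive valid w≢0 ¬0<w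
... | yes 0<w = All.lookup (support-degree-bound outcome valid #supp≡4)
                  (∈-filter⁺ (λ p → + 0 ℤ.<? w (proj₁ p) (proj₂ p)) (∈-V (outcome-inside outcome w≢0)) 0<w)
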